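{- Let $X=\mathcal{M}_O(n,a,b)$ be feasible with $a>1$, and suppose $[v_0,v_a]\in\mathcal{B}$. Then $X$ admits an automorphism of order $2$ that maps $\mathcal{G}$ onto $\mathcal{R}$ and $\mathcal{R}$ onto $\mathcal{G}$ if and only if $8\mid n$, $a=4a_0+1<(n-4)/4$ with $a_0$ odd, $4a_0^2\equiv 4\pmod n$, and $b=n/2+a+2$.
   Context: For even $n\ge4$ and odd $0<a<b<n$, $\mathcal{M}_O(n,a,b)$ has vertices $u_0,\dots,u_{n-1},v_0,\dots,v_{n-1}$ and edges $[u_i,u_{i+1}]$, $[u_i,v_i]$ for all $i$ and $[v_i,v_{i+a}]$, $[v_i,v_{i+b}]$ for even $i$ (subscripts mod $n$). It is feasible if $\gcd(b-a,n)=2$, $(b-a)^2/2\equiv 2\pmod n$, at least one of $a+(a-1)(a-b)/2\equiv1$ or $b+(b-1)(b-a)/2\equiv 1\pmod n$ holds, and $1\le a<b-2<n-a-2$. Let $x=a$ if $a+(a-1)(a-b)/2\equiv 1\pmod n$ and $x=b$ otherwise, and $y$ the other element of $\{a,b\}$. $\mathcal{R}=\{[u_i,v_i]\}$; $\mathcal{B}=\{[u_i,u_{i+1}]: i\text{ even}\}\cup\{[v_j,v_{j+x}]: j\text{ even}\}$; $\mathcal{G}=\{[u_i,u_{i+1}]: i\text{ odd}\}\cup\{[v_j,v_{j+y}]: j\text{ even}\}$. -}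

module Defs where

open import Data.Nat as ℕ using (ℕ; zero; suc; _+_; _*_; _∸_; _<_; _≤_; _%_; _/_; NonZero)
open import Data.Nat.DivMod using (m%n<n)
open import Data.Nat.Divisibility as ℕD using (_∣?_)
open import Data.Nat.GCD using (gcd)
open import Data.Integer as ℤ using (ℤ; +_; ∣_∣)
import Data.Integer.Divisibility as ℤD
open import Data.Fin using (Fin; fromℕ<)
open import Data.Product using (_×_; Σ; ∃; _,_)
open import Data.Sum using (_⊎_)
open import Data.Bool using (if_then_else_)
open import Data.Empty using (⊥)
open import Relation.Nullary using (¬_; does)
open import Relation.Binary.PropositionalEquality using (_≡_; _≢_)

-- Vertices of M_O(n,a,b):  (u , i) is u_i and (v , i) is v_i,  i ∈ {0..n-1}

data Side : Set where
  u v : Side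

Vtx : ℕ → Set
Vtx n = Side × Fin n

vtx : ∀ {n} .{{_ : NonZero n}} → Side → ℕ → Vtx n
vtx {n} s k = s , fromℕ< (m%n<n k n)

data Spoke {n} .{{_ : NonZero n}} : Vtx n → Vtx n → Set where
  spoke : ∀ i → Spoke (vtx u i) (vtx v i)

data Outer {n} .{{_ : NonZero n}} (p : ℕ) : Vtx n → Vtx n → Set where
  outer : ∀ i → i % 2 ≡ p → Outer p (vtx u i) (vtx u (i + 1))

data Inner {n} .{{_ : NonZero n}} (s : ℕ) : Vtx n → Vtx n → Set where
  inner : ∀ i → i % 2 ≡ 0 → Inner s (vtx v i) (vtx v (i + s))

-- union and symmetric closure (edges are unordered pairs)
_∪_ : ∀ {A : Set} → (A → A → Set) → (A → A → Set) → (A → A → Set)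
(R ∪ S) x y = R x y ⊎ S x y

Sym : ∀ {A : Set} → (A → A → Set) → (A → A → Set)
Sym R x y = R x y ⊎ R y x

Edge : ∀ n .{{_ : NonZero n}} → ℕ → ℕ → Vtx n → Vtx n → Set
Edge n a b = Sym (Spoke ∪ (Outer 0 ∪ (Outer 1 ∪ (Inner a ∪ Inner b))))

-- The congruence  c + (c-1)(c-d)/2 ≡ 1 (mod n)  for odd c, computed in ℤ
-- (for odd c, (c-1)(c-d)/2 = ((c-1)/2)·(c-d) exactly)

CongX : ℕ → ℕ → ℕ → Set
CongX n c d = (+ n) ℤD.∣ ((+ c ℤ.+ (+ ((c ∸ 1) / 2)) ℤ.* (+ c ℤ.- + d)) ℤ.- ℤ.1ℤ)

xOf : ℕ → ℕ → ℕ → ℕ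
xOf n a b = if does (n ∣? ∣ (+ a ℤ.+ (+ ((a ∸ 1) / 2)) ℤ.* (+ a ℤ.- + b)) ℤ.- ℤ.1ℤ ∣) then a else b

yOf : ℕ → ℕ → ℕ → ℕ
yOf n a b = if does (n ∣? ∣ (+ a ℤ.+ (+ ((a ∸ 1) / 2)) ℤ.* (+ a ℤ.- + b)) ℤ.- ℤ.1ℤ ∣) then b else a

Feasible : ∀ n .{{_ : NonZero n}} → ℕ → ℕ → Set
Feasible n a b =
    (2 ℕD.∣ n) × (4 ≤ n)
  × (¬ (2 ℕD.∣ a)) × (¬ (2 ℕD.∣ b))
  × (0 < a) × (a < b) × (b < n)
  × (gcd (b ∸ a) n ≡ 2)
  × (((b ∸ a) * (b ∸ a) / 2) % n ≡ 2 % n)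
  × (CongX n a b ⊎ CongX n b a)
  × (1 ≤ a) × (a + 2 < b) × (b ∸ 2 < n ∸ a ∸ 2)

Rc : ∀ n .{{_ : NonZero n}} → ℕ → ℕ → Vtx n → Vtx n → Set
Rc n a b = Sym Spoke

Bc : ∀ n .{{_ : NonZero n}} → ℕ → ℕ → Vtx n → Vtx n → Set
Bc n a b = Sym (Outer 0 ∪ Inner (xOf n a b))

Gc : ∀ n .{{_ : NonZero n}} → ℕ → ℕ → Vtx n → Vtx n → Set
Gc n a b = Sym (Outer 1 ∪ Inner (yOf n a b))

IsAutomorphism : ∀ n .{{_ : NonZero n}} → ℕ → ℕ → (Vtx n → Vtx n) → Set
IsAutomorphism n a b f =
    (Σ (Vtx n → Vtx n) λ g → (∀ x → g (f x) ≡ x) × (∀ x → f (g x) ≡ x))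
  × (∀ x y → (Edge n a b x y → Edge n a b (f x) (f y))
           × (Edge n a b (f x) (f y) → Edge n a b x y))

HasOrder2 : ∀ {A : Set} → (A → A) → Set
HasOrder2 {A} f = (∀ x → f (f x) ≡ x) × (∃ λ x → f x ≢ x)

SwapsGR : ∀ n .{{_ : NonZero n}} → ℕ → ℕ → (Vtx n → Vtx n) → Set
SwapsGR n a b f =
  ∀ x y → ((Gc n a b x y → Rc n a b (f x) (f y)) × (Rc n a b (f x) (f y) → Gc n a b x y))
        × ((Rc n a b x y → Gc n a b (f x) (f y)) × (Gc n a b (f x) (f y) → Rc n a b x y))

Characterisation : ∀ n .{{_ : NonZero n}} → ℕ → ℕ → Set
Characterisation n a b =
    (8 ℕD.∣ n)
  × (Σ ℕ λ a₀ → (a ≡ 4 * a₀ + 1) × (4 * a + 4 < n)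
              × (¬ (2 ℕD.∣ a₀)) × ((4 * a₀ * a₀) % n ≡ 4 % n))
  × (b ≡ n / 2 + a + 2)

-- The colour classes R, B, G are perfect matchings, i.e. fixed-point-free involutions R, B, G of
-- the vertex set, and an involution f swaps G and R (and hence is an automorphism fixing B)
-- exactly when f B = B f, f G = R f and f R = G f.
--
-- Necessity. Put Q = B G, P = B R, T = G B and T′ = R B, so that f P = Q f and f T = T′ f.
-- Q moves every vertex by ±2 or ±(b - a), so Q^(n/2) = 1 and therefore P^(n/2) = 1. As P swaps
-- the sides and P² moves u_i by ±(a - 1), this forces n = 4k and a = 4a₀ + 1. On u-vertices of
-- even index T^(2a₀) = P²; conjugating by f gives T′^(2a₀) = Q² at some u-vertex, which reads
-- 4a₀² ≡ 4 (mod n). With b - a = 2d, the feasibility congruences become d² ≡ 1 (mod 2k) and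
-- a₀(1 - d) ≡ 0 (mod k); as a₀ is a unit mod k, d ≡ 1 (mod k), so d = k + 1, k is even and
-- b = n/2 + a + 2.
--
-- Sufficiency. With n = 8m, define f on u-vertices class by class (class = side and index mod 4),
-- acting on the quotient K of the index by K ↦ -a₀ K + const, and on v-vertices by f R = G f.
-- The remaining relations f B = B f and f² = 1 reduce to finitely many congruences mod 2m, which
-- follow from a₀² ≡ 1 (mod 2m) and a₀ odd.

module Submission where

open import Defs
open import Data.Bool using (if_then_else_)
open import Data.Empty using (⊥; ⊥-elim)
open import Data.Fin using (Fin; toℕ; fromℕ<)
open import Data.Fin.Patterns using (0F; 1F; 2F; 3F)
import Data.Fin.Properties as Fin
open import Data.Integer as ℤ using (ℤ; +_; _+_; _-_; _*_; -_; ∣_∣; _%ℕ_; _/ℕ_)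
open import Data.Integer.DivMod using (n%ℕd<d; a≡a%ℕn+[a/ℕn]*n)
open import Data.Integer.Divisibility.Signed
  using (_∣_; divides; _∣?_; ∣⇒∣ᵤ; ∣ᵤ⇒∣; ∣m∣n⇒∣m+n; ∣m∣n⇒∣m-n; ∣m⇒∣-m; ∣m⇒∣m*n; ∣n⇒∣m*n; ∣-refl; ∣-trans; *-cancelˡ-∣)
import Data.Integer.Properties as ℤ
open import Data.Integer.Tactic.RingSolver using (solve-∀; solve)
open import Data.List using (_∷_; [])
open import Data.Nat as ℕ using (ℕ; zero; suc; NonZero; _<_)
import Data.Nat.DivMod as ℕ
import Data.Nat.Divisibility as ℕ
open import Data.Nat.GeneralisedArithmetic using (fold; fold-*)
import Data.Nat.Properties as ℕ
import Data.Nat.Tactic.RingSolver as ℕ-Solver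
open import Data.Product using (_×_; _,_; proj₁; proj₂; Σ; ∃)
open import Data.Sum using (_⊎_; inj₁; inj₂; swap)
open import Function.Bundles using (_⇔_; mk⇔)
open import Relation.Binary.PropositionalEquality
open import Relation.Nullary using (¬_; Dec; yes; no; does)
open import Relation.Nullary.Decidable using (dec-true; dec-false)

infixl 4 _∣≡_
_∣≡_ : ∀ {k i j} → k ∣ i → i ≡ j → k ∣ j
k∣i ∣≡ refl = k∣i

-- Parity and the sign (-1)^i

Even Odd : ℤ → Set
Even i = + 2 ∣ i
Odd i = + 2 ∣ i - + 1

even⊎odd : ∀ i → Even i ⊎ Odd i
even⊎odd i with i %ℕ 2 | n%ℕd<d i 2 | a≡a%ℕn+[a/ℕn]*n i 2
... | 0 | _ | i≡ = inj₁ (divides (i /ℕ 2) (trans i≡ (ℤ.+-identityˡ _)))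
... | 1 | _ | i≡ = inj₂ (divides (i /ℕ 2) (trans (cong (_- + 1) i≡) (odd-form (i /ℕ 2))))
  where
  odd-form : ∀ q → (+ 1 + q * + 2) - + 1 ≡ q * + 2
  odd-form = solve-∀
... | suc (suc _) | ℕ.s≤s (ℕ.s≤s ()) | _

¬even∧odd : ∀ {i} → Even i → Odd i → ⊥
¬even∧odd {i} e o = 2∤1 (∣m∣n⇒∣m-n e o ∣≡ solve (i ∷ []))
  where
  2∤1 : ¬ (+ 2 ∣ + 1)
  2∤1 d = ℕ.<⇒≱ (ℕ.s≤s (ℕ.s≤s ℕ.z≤n)) (ℕ.∣⇒≤ (∣⇒∣ᵤ d))

ε : ℤ → ℤ
ε i = if does (+ 2 ∣? i) then + 1 else - + 1

ε-even : ∀ i → Even i → ε i ≡ + 1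
ε-even i e rewrite dec-true (+ 2 ∣? i) e = refl

ε-odd : ∀ i → Odd i → ε i ≡ - + 1
ε-odd i o rewrite dec-false (+ 2 ∣? i) (λ e → ¬even∧odd e o) = refl

ε-cong : ∀ i j → Even (i - j) → ε i ≡ ε j
ε-cong i j e with even⊎odd i | even⊎odd j
... | inj₁ ei | inj₁ ej = trans (ε-even i ei) (sym (ε-even j ej))
... | inj₂ oi | inj₂ oj = trans (ε-odd i oi) (sym (ε-odd j oj))
... | inj₁ ei | inj₂ oj = ⊥-elim (¬even∧odd ei (∣m∣n⇒∣m+n e oj ∣≡ solve (i ∷ j ∷ [])))
... | inj₂ oi | inj₁ ej = ⊥-elim (¬even∧odd ej (∣m∣n⇒∣m-n oi e ∣≡ solve (i ∷ j ∷ [])))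

ε-+odd : ∀ i {j} → Odd j → ε (i + j) ≡ - ε i
ε-+odd i {j} o with even⊎odd i
... | inj₁ e = trans (ε-odd (i + j) (∣m∣n⇒∣m+n e o ∣≡ solve (i ∷ j ∷ []))) (cong -_ (sym (ε-even i e)))
... | inj₂ o′ = trans (ε-even (i + j) (∣m∣n⇒∣m+n (∣m∣n⇒∣m+n o′ o) ∣-refl ∣≡ solve (i ∷ j ∷ [])))
                      (cong -_ (sym (ε-odd i o′)))

ε-+even : ∀ i {j} → Even j → ε (i + j) ≡ ε i
ε-+even i {j} e = ε-cong (i + j) i (e ∣≡ solve (i ∷ j ∷ []))

ε²≡1 : ∀ i → ε i * ε i ≡ + 1
ε²≡1 i with even⊎odd i
... | inj₁ e rewrite ε-even i e = refl
... | inj₂ o rewrite ε-odd i o = refl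

∣ε*⇒∣ : ∀ {k x} i → k ∣ ε i * x → k ∣ x
∣ε*⇒∣ {k} {x} i k∣ = ∣n⇒∣m*n (ε i) k∣ ∣≡ trans (sym (ℤ.*-assoc (ε i) (ε i) x))
                                                     (trans (cong (_* x) (ε²≡1 i)) (ℤ.*-identityˡ x))

odd-ε* : ∀ i {c} → Odd c → Odd (ε i * c)
odd-ε* i {c} o with even⊎odd i
... | inj₁ e rewrite ε-even i e = o ∣≡ cong (_- + 1) (sym (ℤ.*-identityˡ c))
... | inj₂ o′ rewrite ε-odd i o′ = ∣m∣n⇒∣m-n (∣m⇒∣-m o) ∣-refl ∣≡ negate c
  where
  negate : ∀ c → - (c - + 1) - + 2 ≡ - + 1 * c - + 1
  negate = solve-∀

%2≡⇒even : ∀ {i p} → i ℕ.% 2 ≡ p → Even (+ i + + p)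
%2≡⇒even {i} {p} refl = divides (+ (i ℕ.% 2) + + (i ℕ./ 2)) (begin
  + i + + (i ℕ.% 2)                         ≡⟨ cong (λ m → + m + + (i ℕ.% 2)) (ℕ.m≡m%n+[m/n]*n i 2) ⟩
  + (i ℕ.% 2 ℕ.+ i ℕ./ 2 ℕ.* 2) + + (i ℕ.% 2) ≡⟨ cong (_+ + (i ℕ.% 2)) (ℤ.pos-+ (i ℕ.% 2) _) ⟩
  + (i ℕ.% 2) + + (i ℕ./ 2 ℕ.* 2) + + (i ℕ.% 2) ≡⟨ cong (λ m → + (i ℕ.% 2) + m + + (i ℕ.% 2)) (ℤ.pos-* (i ℕ./ 2) 2) ⟩
  + (i ℕ.% 2) + + (i ℕ./ 2) * + 2 + + (i ℕ.% 2) ≡⟨ regroup (+ (i ℕ.% 2)) (+ (i ℕ./ 2)) ⟩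
  (+ (i ℕ.% 2) + + (i ℕ./ 2)) * + 2           ∎)
  where
  open ≡-Reasoning
  regroup : ∀ r q → r + q * + 2 + r ≡ (r + q) * + 2
  regroup = solve-∀

even⇒%2≡ : ∀ {i p} → p ℕ.< 2 → Even (+ i + + p) → i ℕ.% 2 ≡ p
even⇒%2≡ {i} {0} _ e = ℕ.n∣m⇒m%n≡0 i 2 (∣⇒∣ᵤ (e ∣≡ ℤ.+-identityʳ (+ i)))
even⇒%2≡ {i} {1} _ e with i ℕ.% 2 in eq | ℕ.m%n<n i 2
... | 0 | _ = ⊥-elim (¬even∧odd (%2≡⇒even {i} {0} eq ∣≡ ℤ.+-identityʳ (+ i)) (∣m∣n⇒∣m-n e ∣-refl ∣≡ drop2 (+ i)))
  where
  drop2 : ∀ j → j + + 1 - + 2 ≡ j - + 1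
  drop2 = solve-∀
... | 1 | _ = refl
... | suc (suc _) | ℕ.s≤s (ℕ.s≤s ())
even⇒%2≡ {p = suc (suc _)} (ℕ.s≤s (ℕ.s≤s ())) _

¬2∣⇒odd : ∀ {m} → ¬ 2 ℕ.∣ m → Odd (+ m)
¬2∣⇒odd {m} ¬2∣m with even⊎odd (+ m)
... | inj₁ e = ⊥-elim (¬2∣m (∣⇒∣ᵤ e))
... | inj₂ o = o

-- Vertices with integer indices, taken mod n

module Indices (n : ℕ) .{{_ : NonZero n}} where

  N : ℤ
  N = + n

  V : Side → ℤ → Vtx n
  V s i = s , fromℕ< (n%ℕd<d i n)

  residue-unique : ∀ {r₁ r₂} → r₁ ℕ.< n → r₂ ℕ.< n → N ∣ + r₁ - + r₂ → r₁ ≡ r₂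
  residue-unique {r₁} {r₂} r₁<n r₂<n N∣ =
    ℤ.+-injective (ℤ.i-j≡0⇒i≡j (+ r₁) (+ r₂) (ℤ.∣i∣≡0⇒i≡0 multiple-below-n))
    where
    below-n : ∣ + r₁ - + r₂ ∣ ℕ.< n
    below-n = subst (ℕ._< n) (cong ∣_∣ (sym (ℤ.m-n≡m⊖n r₁ r₂)))
                    (ℕ.≤-<-trans (ℤ.∣m⊝n∣≤m⊔n r₁ r₂) (ℕ.⊔-lub r₁<n r₂<n))
    multiple-below-n : ∣ + r₁ - + r₂ ∣ ≡ 0
    multiple-below-n = trans (sym (ℕ.m<n⇒m%n≡m below-n)) (ℕ.n∣m⇒m%n≡0 _ n (∣⇒∣ᵤ N∣))

  0<m<n⇒N∤m : ∀ {m} → 0 ℕ.< m → m ℕ.< n → ¬ N ∣ + m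
  0<m<n⇒N∤m {m} 0<m m<n N∣m =
    ℕ.<⇒≢ 0<m (sym (residue-unique m<n (ℕ.<-trans 0<m m<n) (N∣m ∣≡ sym (ℤ.+-identityʳ (+ m)))))

  N∣i-rep : ∀ i → N ∣ i - + (i %ℕ n)
  N∣i-rep i = divides (i /ℕ n) (trans (cong (_- + (i %ℕ n)) (a≡a%ℕn+[a/ℕn]*n i n)) (cancel (+ (i %ℕ n)) (i /ℕ n) N))
    where
    cancel : ∀ r q m → (r + q * m) - r ≡ q * m
    cancel = solve-∀

  N∣⇒%ℕ≡ : ∀ i j → N ∣ i - j → i %ℕ n ≡ j %ℕ n
  N∣⇒%ℕ≡ i j N∣ = residue-unique (n%ℕd<d i n) (n%ℕd<d j n)
    (∣m∣n⇒∣m+n (∣m∣n⇒∣m-n N∣ (N∣i-rep i)) (N∣i-rep j) ∣≡ telescope i j _ _)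
    where
    telescope : ∀ i j r₁ r₂ → ((i - j) - (i - r₁)) + (j - r₂) ≡ r₁ - r₂
    telescope = solve-∀

  %ℕ≡⇒N∣ : ∀ i j → i %ℕ n ≡ j %ℕ n → N ∣ i - j
  %ℕ≡⇒N∣ i j i≡j =
    ∣m∣n⇒∣m-n (N∣i-rep i) (N∣i-rep j) ∣≡ trans (cong (λ r → (i - + (i %ℕ n)) - (j - + r)) (sym i≡j)) (cancel i j _)
    where
    cancel : ∀ i j r → (i - r) - (j - r) ≡ i - j
    cancel = solve-∀

  V-cong : ∀ s i j → N ∣ i - j → V s i ≡ V s j
  V-cong s i j N∣ = cong (s ,_) (Fin.fromℕ<-cong _ _ (N∣⇒%ℕ≡ i j N∣) _ _)

  V-injective : ∀ s i j → V s i ≡ V s j → N ∣ i - j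
  V-injective s i j eq = %ℕ≡⇒N∣ i j (trans (sym (Fin.toℕ-fromℕ< (n%ℕd<d i n)))
                                           (trans (cong (λ p → toℕ (proj₂ p)) eq) (Fin.toℕ-fromℕ< (n%ℕd<d j n))))

  V-toℕ : ∀ (p : Vtx n) → V (proj₁ p) (+ toℕ (proj₂ p)) ≡ p
  V-toℕ (s , k) = cong (s ,_) (trans (Fin.fromℕ<-cong _ _ (ℕ.m<n⇒m%n≡m (Fin.toℕ<n k)) _ (Fin.toℕ<n k))
                                     (Fin.fromℕ<-toℕ k (Fin.toℕ<n k)))

Sound Complete : ∀ {A : Set} → (A → A → Set) → (A → A) → Set
Sound C M = ∀ {x y} → C x y → y ≡ M x
Complete C M = ∀ x → C x (M x)

conjugate-graphs : ∀ {A : Set} {f : A → A} {C C′ : A → A → Set} {M M′ : A → A} → (∀ x → f (f x) ≡ x) →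
                   Sound C M → Complete C M → Sound C′ M′ → Complete C′ M′ → (∀ x → f (M x) ≡ M′ (f x)) →
                   ∀ x y → (C x y → C′ (f x) (f y)) × (C′ (f x) (f y) → C x y)
conjugate-graphs {f = f} {C} {C′} {M} {M′} f-involutive C-sound C-complete C′-sound C′-complete comm x y =
  (λ c → subst (C′ (f x)) (sym (trans (cong f (C-sound c)) (comm x))) (C′-complete (f x))) ,
  (λ c′ → subst (C x) (sym (begin
    y               ≡⟨ sym (f-involutive y) ⟩
    f (f y)         ≡⟨ cong f (C′-sound c′) ⟩
    f (M′ (f x))    ≡⟨ cong f (sym (comm x)) ⟩
    f (f (M x))     ≡⟨ f-involutive (M x) ⟩
    M x             ∎)) (C-complete x))
  where open ≡-Reasoning

fold-conj : ∀ {A B : Set} (f : A → B) {F : A → A} {H : B → B} → (∀ x → f (F x) ≡ H (f x)) →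
            ∀ x k → f (fold x F k) ≡ fold (f x) H k
fold-conj f         comm x zero    = refl
fold-conj f {F} {H} comm x (suc k) = trans (comm (fold x F k)) (cong H (fold-conj f comm x k))

module Alternating (n : ℕ) .{{_ : NonZero n}} where

  open Indices n

  record Alternates (F : Vtx n → Vtx n) (s s′ : Side) (c : ℤ) : Set where
    constructor alternating
    field step : ∀ i → F (V s i) ≡ V s′ (i + ε i * c)

  open Alternates public

  alternates-resp : ∀ {F s s′ c d} → c ≡ d → Alternates F s s′ c → Alternates F s s′ d
  alternates-resp refl F-alt = F-alt

  alternates-∘-odd : ∀ {F H s s′ s″ c d} → Odd c → Alternates F s s′ c → Alternates H s′ s″ d →
                     Alternates (λ x → H (F x)) s s″ (c - d)
  alternates-∘-odd {F} {H} {s} {s′} {s″} {c} {d} c-odd F-alt H-alt = alternating λ i → begin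
    H (F (V s i))                            ≡⟨ cong H (step F-alt i) ⟩
    H (V s′ (i + ε i * c))                ≡⟨ step H-alt (i + ε i * c) ⟩
    V s″ (i + ε i * c + ε (i + ε i * c) * d)   ≡⟨ cong (λ σ → V s″ (i + ε i * c + σ * d)) (ε-+odd i (odd-ε* i c-odd)) ⟩
    V s″ (i + ε i * c + - ε i * d)     ≡⟨ cong (V s″) (regroup i (ε i) c d) ⟩
    V s″ (i + ε i * (c - d))              ∎
    where
    open ≡-Reasoning
    regroup : ∀ i σ c d → i + σ * c + - σ * d ≡ i + σ * (c - d)
    regroup = solve-∀

  alternates-∘-even : ∀ {F H s s′ s″ c d} → Even c → Alternates F s s′ c → Alternates H s′ s″ d →
                      Alternates (λ x → H (F x)) s s″ (c + d)
  alternates-∘-even {F} {H} {s} {s′} {s″} {c} {d} c-even F-alt H-alt = alternating λ i → begin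
    H (F (V s i))                            ≡⟨ cong H (step F-alt i) ⟩
    H (V s′ (i + ε i * c))                ≡⟨ step H-alt (i + ε i * c) ⟩
    V s″ (i + ε i * c + ε (i + ε i * c) * d)   ≡⟨ cong (λ σ → V s″ (i + ε i * c + σ * d)) (ε-+even i (∣n⇒∣m*n (ε i) c-even)) ⟩
    V s″ (i + ε i * c + ε i * d)       ≡⟨ cong (V s″) (regroup i (ε i) c d) ⟩
    V s″ (i + ε i * (c + d))              ∎
    where
    open ≡-Reasoning
    regroup : ∀ i σ c d → i + σ * c + σ * d ≡ i + σ * (c + d)
    regroup = solve-∀

  fold-alternating : ∀ {F s c} → Even c → Alternates F s s c →
                     ∀ i k → fold (V s i) F k ≡ V s (i + + k * (ε i * c))
  fold-alternating {F} {s} {c} c-even F-step i zero = cong (V s) (no-steps i (ε i * c))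
    where
    no-steps : ∀ i d → i ≡ i + + 0 * d
    no-steps = solve-∀
  fold-alternating {F} {s} {c} c-even F-step i (suc k) = begin
    F (fold (V s i) F k)                       ≡⟨ cong F (fold-alternating c-even F-step i k) ⟩
    F (V s j)                                  ≡⟨ step F-step j ⟩
    V s (j + ε j * c)                       ≡⟨ cong (λ σ → V s (j + σ * c)) (ε-+even i (∣n⇒∣m*n (+ k) (∣n⇒∣m*n (ε i) c-even))) ⟩
    V s (j + ε i * c)                       ≡⟨ cong (V s) (one-more i (+ k) (ε i * c)) ⟩
    V s (i + + suc k * (ε i * c))           ∎
    where
    open ≡-Reasoning
    j : ℤ
    j = i + + k * (ε i * c)
    one-more : ∀ i k d → (i + k * d) + d ≡ i + (+ 1 + k) * d
    one-more = solve-∀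

-- The three colour classes as involutions

flip : Side → Side
flip u = v
flip v = u

module Matchings (n : ℕ) .{{_ : NonZero n}} (n-even : Even (+ n)) where

  open Indices n public
  open Alternating n public

  -- The partner of a vertex in the perfect matching Sym (Outer p ∪ Inner s), for p < 2 and s odd.
  mate : ℕ → ℕ → Vtx n → Vtx n
  mate p s (u , k) = V u (+ toℕ k + ε (+ toℕ k + + p))
  mate p s (v , k) = V v (+ toℕ k + ε (+ toℕ k) * + s)

  private
    V-shift : ∀ s i (g : ℤ → ℤ) → (∀ {j k} → Even (j - k) → g j ≡ g k) →
              V s (+ toℕ (proj₂ (V s i)) + g (+ toℕ (proj₂ (V s i)))) ≡ V s (i + g i)
    V-shift s i g g-parity = begin
      V s (r + g r) ≡⟨ cong (λ x → V s (r + x)) (g-parity {r} {i} (∣-trans n-even N∣r-i)) ⟩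
      V s (r + g i) ≡⟨ V-cong s (r + g i) (i + g i) (N∣r-i ∣≡ shift-diff r i (g i)) ⟩
      V s (i + g i) ∎
      where
      open ≡-Reasoning
      r : ℤ
      r = + toℕ (proj₂ (V s i))
      N∣r-i : N ∣ r - i
      N∣r-i = subst (λ m → N ∣ + m - i) (sym (Fin.toℕ-fromℕ< (n%ℕd<d i n))) (∣m⇒∣-m (N∣i-rep i) ∣≡ negate-diff i _)
        where
        negate-diff : ∀ i r → - (i - r) ≡ r - i
        negate-diff = solve-∀
      shift-diff : ∀ r i x → r - i ≡ (r + x) - (i + x)
      shift-diff = solve-∀

  mate-u : ∀ p s i → mate p s (V u i) ≡ V u (i + ε (i + + p))
  mate-u p s i = V-shift u i (λ j → ε (j + + p)) (λ {j} {k} e → ε-cong (j + + p) (k + + p) (e ∣≡ shift-diff j k (+ p)))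
    where
    shift-diff : ∀ j k p → j - k ≡ (j + p) - (k + p)
    shift-diff = solve-∀

  mate-v : ∀ p s → Alternates (mate p s) v v (+ s)
  mate-v p s = alternating λ i → V-shift v i (λ j → ε j * + s) (λ {j} {k} e → cong (_* + s) (ε-cong j k e))

  private
    outer-forward : ∀ p s {i} → Even (+ i + + p) → mate p s (vtx u i) ≡ vtx u (i ℕ.+ 1)
    outer-forward p s {i} e = trans (mate-u p s (+ i)) (cong (λ x → V u (+ i + x)) (ε-even _ e))

    inner-forward : ∀ p s {i} → Even (+ i) → mate p s (vtx v i) ≡ vtx v (i ℕ.+ s)
    inner-forward p s {i} e =
      trans (step (mate-v p s) (+ i)) (cong (λ x → V v (+ i + x)) (trans (cong (_* + s) (ε-even _ e)) (ℤ.*-identityˡ (+ s))))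

    outer-backward : ∀ p s {i} → Odd (+ i + + p) → mate p s (vtx u i) ≡ V u (+ i - + 1)
    outer-backward p s {i} o = trans (mate-u p s (+ i)) (cong (λ x → V u (+ i + x)) (ε-odd (+ i + + p) o))

    inner-backward : ∀ p s {i} → Odd (+ i) → mate p s (vtx v i) ≡ V v (+ i - + s)
    inner-backward p s {i} o =
      trans (step (mate-v p s) (+ i)) (cong (λ x → V v (+ i + x)) (trans (cong (_* + s) (ε-odd (+ i) o)) (ℤ.-1*i≡-i (+ s))))

    wrap : ∀ t k → k ℕ.≤ n → + (t ℕ.+ (n ℕ.∸ k)) ≡ (+ t - + k) + N
    wrap t k k≤n = begin
      + t + + (n ℕ.∸ k)   ≡⟨ cong (λ x → + t + x) (trans (sym (ℤ.⊖-≥ k≤n)) (sym (ℤ.m-n≡m⊖n n k))) ⟩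
      + t + (N - + k)     ≡⟨ regroup (+ t) N (+ k) ⟩
      (+ t - + k) + N     ∎
      where
      open ≡-Reasoning
      regroup : ∀ t n k → t + (n - k) ≡ (t - k) + n
      regroup = solve-∀

    wrap-start : ∀ s t k → k ℕ.≤ n → vtx s (t ℕ.+ (n ℕ.∸ k)) ≡ V s (+ t - + k)
    wrap-start s t k k≤n = V-cong s (+ (t ℕ.+ (n ℕ.∸ k))) (+ t - + k) (∣-refl ∣≡ trans (drop (+ t - + k) N) (cong (_- (+ t - + k)) (sym (wrap t k k≤n))))
      where
      drop : ∀ x n → n ≡ (x + n) - x
      drop = solve-∀

    wrap-end : ∀ s t k → k ℕ.≤ n → vtx s ((t ℕ.+ (n ℕ.∸ k)) ℕ.+ k) ≡ vtx s t
    wrap-end s t k k≤n = V-cong s (+ (t ℕ.+ (n ℕ.∸ k) ℕ.+ k)) (+ t) (∣-refl ∣≡ trans (drop (+ t) (+ k) N) (cong (λ x → x + + k - + t) (sym (wrap t k k≤n))))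
      where
      drop : ∀ t k n → n ≡ ((t - k) + n) + k - t
      drop = solve-∀

  mate-sound : ∀ {p s} → Odd (+ s) → ∀ {x y} → Sym (Outer p ∪ Inner s) x y → y ≡ mate p s x
  mate-sound {p} {s} s-odd (inj₁ (inj₁ (outer i i≡p))) = sym (outer-forward p s (%2≡⇒even i≡p))
  mate-sound {p} {s} s-odd (inj₁ (inj₂ (inner i i-even))) =
    sym (inner-forward p s (%2≡⇒even i-even ∣≡ ℤ.+-identityʳ (+ i)))
  mate-sound {p} {s} s-odd (inj₂ (inj₁ (outer i i≡p))) =
    sym (trans (outer-backward p s (%2≡⇒even i≡p ∣≡ regroup (+ i) (+ p))) (cong (V u) (cancel (+ i))))
    where
    regroup : ∀ i p → i + p ≡ ((i + + 1) + p) - + 1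
    regroup = solve-∀
    cancel : ∀ i → (i + + 1) - + 1 ≡ i
    cancel = solve-∀
  mate-sound {p} {s} s-odd (inj₂ (inj₂ (inner i i-even))) =
    sym (trans (inner-backward p s (∣m∣n⇒∣m+n (%2≡⇒even i-even) s-odd ∣≡ regroup (+ i) (+ s))) (cong (V v) (cancel (+ i) (+ s))))
    where
    regroup : ∀ i s → (i + + 0) + (s - + 1) ≡ (i + s) - + 1
    regroup = solve-∀
    cancel : ∀ i s → (i + s) - s ≡ i
    cancel = solve-∀

  mate-complete : ∀ {p s} → p ℕ.< 2 → Odd (+ s) → s ℕ.≤ n → ∀ x → Sym (Outer p ∪ Inner s) x (mate p s x)
  mate-complete {p} {s} p<2 s-odd s≤n x = subst (λ x → Sym (Outer p ∪ Inner s) x (mate p s x)) (V-toℕ x)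
                                                (at (proj₁ x) (toℕ (proj₂ x)))
    where
    at : ∀ side t → Sym (Outer p ∪ Inner s) (vtx side t) (mate p s (vtx side t))
    at u t with even⊎odd (+ t + + p)
    ... | inj₁ e = inj₁ (inj₁ (subst (Outer p (vtx u t)) (sym (outer-forward p s e)) (outer t (even⇒%2≡ p<2 e))))
    ... | inj₂ o = inj₂ (inj₁ (subst₂ (Outer p) (trans (wrap-start u t 1 1≤n) (sym (outer-backward p s o)))
                                                 (wrap-end u t 1 1≤n)
                                                 (outer (t ℕ.+ (n ℕ.∸ 1)) (even⇒%2≡ p<2 start-even))))
      where
      1≤n : 1 ℕ.≤ n
      1≤n = ℕ.>-nonZero⁻¹ n
      start-even : Even (+ (t ℕ.+ (n ℕ.∸ 1)) + + p)
      start-even = ∣m∣n⇒∣m+n o n-even ∣≡ trans (regroup (+ t) (+ p) N) (cong (_+ + p) (sym (wrap t 1 1≤n)))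
        where
        regroup : ∀ t p n → (t + p - + 1) + n ≡ ((t - + 1) + n) + p
        regroup = solve-∀
    at v t with even⊎odd (+ t)
    ... | inj₁ e = inj₁ (inj₂ (subst (Inner s (vtx v t)) (sym (inner-forward p s e)) (inner t (even⇒%2≡ (ℕ.s≤s ℕ.z≤n) (e ∣≡ sym (ℤ.+-identityʳ (+ t)))))))
    ... | inj₂ o = inj₂ (inj₂ (subst₂ (Inner s) (trans (wrap-start v t s s≤n) (sym (inner-backward p s o)))
                                                 (wrap-end v t s s≤n)
                                                 (inner (t ℕ.+ (n ℕ.∸ s)) (even⇒%2≡ (ℕ.s≤s ℕ.z≤n) start-even))))
      where
      start-even : Even (+ (t ℕ.+ (n ℕ.∸ s)) + + 0)
      start-even = ∣m∣n⇒∣m+n (∣m∣n⇒∣m-n o s-odd) n-even ∣≡ trans (regroup (+ t) (+ s) N) (cong (_+ + 0) (sym (wrap t s s≤n)))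
        where
        regroup : ∀ t s n → ((t - + 1) - (s - + 1)) + n ≡ ((t - s) + n) + + 0
        regroup = solve-∀

  mate-involutive : ∀ {p s} → p ℕ.< 2 → Odd (+ s) → s ℕ.≤ n → ∀ x → mate p s (mate p s x) ≡ x
  mate-involutive p<2 s-odd s≤n x = sym (mate-sound s-odd (swap (mate-complete p<2 s-odd s≤n x)))

module Colouring (n a b : ℕ) .{{_ : NonZero n}} (n-even : Even (+ n))
                 (a-odd : Odd (+ a)) (b-odd : Odd (+ b)) (2<n : 2 ℕ.< n) (a<b : a ℕ.< b) (b<n : b ℕ.< n) where

  open Matchings n n-even public

  B G R : Vtx n → Vtx n
  B = mate 0 a
  G = mate 1 b
  R (s , k) = flip s , k

  B-u : Alternates B u u (+ 1)
  B-u = alternating λ i → trans (mate-u 0 a i) (cong (λ σ → V u (i + σ)) (trans (cong ε (ℤ.+-identityʳ i)) (sym (ℤ.*-identityʳ (ε i)))))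

  G-u : Alternates G u u (- + 1)
  G-u = alternating λ i → trans (mate-u 1 b i) (cong (λ σ → V u (i + σ)) (trans (ε-+odd i {+ 1} (divides (+ 0) refl))
                                                           (trans (cong -_ (sym (ℤ.*-identityʳ (ε i)))) (ℤ.neg-distribʳ-* (ε i) (+ 1)))))

  B-v : Alternates B v v (+ a)
  B-v = mate-v 0 a

  G-v : Alternates G v v (+ b)
  G-v = mate-v 1 b

  R-u : Alternates R u v (+ 0)
  R-u = alternating λ i → cong (V v) (sym (trans (cong (_+_ i) (ℤ.*-zeroʳ (ε i))) (ℤ.+-identityʳ i)))

  R-v : Alternates R v u (+ 0)
  R-v = alternating λ i → cong (V u) (sym (trans (cong (_+_ i) (ℤ.*-zeroʳ (ε i))) (ℤ.+-identityʳ i)))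

  Rᶜ Bᶜ Gᶜ : Vtx n → Vtx n → Set
  Rᶜ = Sym Spoke
  Bᶜ = Sym (Outer 0 ∪ Inner a)
  Gᶜ = Sym (Outer 1 ∪ Inner b)

  edge⇒colour : ∀ {x y} → Edge n a b x y → Rᶜ x y ⊎ Bᶜ x y ⊎ Gᶜ x y
  edge⇒colour (inj₁ (inj₁ e))                         = inj₁ (inj₁ e)
  edge⇒colour (inj₁ (inj₂ (inj₁ e)))                  = inj₂ (inj₁ (inj₁ (inj₁ e)))
  edge⇒colour (inj₁ (inj₂ (inj₂ (inj₁ e))))           = inj₂ (inj₂ (inj₁ (inj₁ e)))
  edge⇒colour (inj₁ (inj₂ (inj₂ (inj₂ (inj₁ e)))))    = inj₂ (inj₁ (inj₁ (inj₂ e)))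
  edge⇒colour (inj₁ (inj₂ (inj₂ (inj₂ (inj₂ e)))))    = inj₂ (inj₂ (inj₁ (inj₂ e)))
  edge⇒colour (inj₂ (inj₁ e))                         = inj₁ (inj₂ e)
  edge⇒colour (inj₂ (inj₂ (inj₁ e)))                  = inj₂ (inj₁ (inj₂ (inj₁ e)))
  edge⇒colour (inj₂ (inj₂ (inj₂ (inj₁ e))))           = inj₂ (inj₂ (inj₂ (inj₁ e)))
  edge⇒colour (inj₂ (inj₂ (inj₂ (inj₂ (inj₁ e)))))    = inj₂ (inj₁ (inj₂ (inj₂ e)))
  edge⇒colour (inj₂ (inj₂ (inj₂ (inj₂ (inj₂ e)))))    = inj₂ (inj₂ (inj₂ (inj₂ e)))

  Rᶜ⇒edge : ∀ {x y} → Rᶜ x y → Edge n a b x y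
  Rᶜ⇒edge (inj₁ e) = inj₁ (inj₁ e)
  Rᶜ⇒edge (inj₂ e) = inj₂ (inj₁ e)

  Bᶜ⇒edge : ∀ {x y} → Bᶜ x y → Edge n a b x y
  Bᶜ⇒edge (inj₁ (inj₁ e)) = inj₁ (inj₂ (inj₁ e))
  Bᶜ⇒edge (inj₁ (inj₂ e)) = inj₁ (inj₂ (inj₂ (inj₂ (inj₁ e))))
  Bᶜ⇒edge (inj₂ (inj₁ e)) = inj₂ (inj₂ (inj₁ e))
  Bᶜ⇒edge (inj₂ (inj₂ e)) = inj₂ (inj₂ (inj₂ (inj₂ (inj₁ e))))

  Gᶜ⇒edge : ∀ {x y} → Gᶜ x y → Edge n a b x y
  Gᶜ⇒edge (inj₁ (inj₁ e)) = inj₁ (inj₂ (inj₂ (inj₁ e)))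
  Gᶜ⇒edge (inj₁ (inj₂ e)) = inj₁ (inj₂ (inj₂ (inj₂ (inj₂ e))))
  Gᶜ⇒edge (inj₂ (inj₁ e)) = inj₂ (inj₂ (inj₂ (inj₁ e)))
  Gᶜ⇒edge (inj₂ (inj₂ e)) = inj₂ (inj₂ (inj₂ (inj₂ (inj₂ e))))

  R-sound : ∀ {x y} → Rᶜ x y → y ≡ R x
  R-sound (inj₁ (spoke i)) = refl
  R-sound (inj₂ (spoke i)) = refl

  R-complete : ∀ x → Rᶜ x (R x)
  R-complete x = subst (λ x → Rᶜ x (R x)) (V-toℕ x) (at (proj₁ x) (toℕ (proj₂ x)))
    where
    at : ∀ s t → Rᶜ (vtx s t) (R (vtx s t))
    at u t = inj₁ (spoke t)
    at v t = inj₂ (spoke t)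

  B-sound : ∀ {x y} → Bᶜ x y → y ≡ B x
  B-sound = mate-sound a-odd

  G-sound : ∀ {x y} → Gᶜ x y → y ≡ G x
  G-sound = mate-sound b-odd

  B-complete : ∀ x → Bᶜ x (B x)
  B-complete = mate-complete (ℕ.s≤s ℕ.z≤n) a-odd (ℕ.<⇒≤ (ℕ.<-trans a<b b<n))

  G-complete : ∀ x → Gᶜ x (G x)
  G-complete = mate-complete (ℕ.s≤s (ℕ.s≤s ℕ.z≤n)) b-odd (ℕ.<⇒≤ b<n)

  G-involutive : ∀ x → G (G x) ≡ x
  G-involutive = mate-involutive (ℕ.s≤s (ℕ.s≤s ℕ.z≤n)) b-odd (ℕ.<⇒≤ b<n)

  B≢R : ∀ x → B x ≢ R x
  B≢R (u , k) ()
  B≢R (v , k) ()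

  N∤ε* : ∀ {m} i → 0 ℕ.< m → m ℕ.< n → ¬ N ∣ ε i * + m
  N∤ε* {m} i 0<m m<n N∣ = 0<m<n⇒N∤m 0<m m<n N∣m
    where
    negate² : ∀ m → - (- + 1 * m) ≡ m
    negate² = solve-∀
    N∣m : N ∣ + m
    N∣m with even⊎odd i
    ... | inj₁ e = N∣ ∣≡ trans (cong (_* + m) (ε-even i e)) (ℤ.*-identityˡ (+ m))
    ... | inj₂ o = ∣m⇒∣-m N∣ ∣≡ trans (cong (λ σ → - (σ * + m)) (ε-odd i o)) (negate² (+ m))

  B≢G : ∀ x → B x ≢ G x
  B≢G (u , k) eq = N∤ε* t (ℕ.s≤s ℕ.z≤n) 2<n
    (V-injective u (t + ε (t + + 0)) (t + ε (t + + 1)) eq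
      ∣≡ trans (cong₂ (λ σ τ → (t + σ) - (t + τ)) (cong ε (ℤ.+-identityʳ t)) (ε-+odd t {+ 1} (divides (+ 0) refl)))
               (difference t (ε t)))
    where
    t : ℤ
    t = + toℕ k
    difference : ∀ t σ → (t + σ) - (t + - σ) ≡ σ * + 2
    difference = solve-∀
  B≢G (v , k) eq = N∤ε* t (ℕ.m<n⇒0<n∸m a<b) (ℕ.≤-<-trans (ℕ.m∸n≤m b a) b<n)
    (∣m⇒∣-m (V-injective v (t + ε t * + a) (t + ε t * + b) eq)
      ∣≡ trans (difference t (ε t) (+ a) (+ b)) (cong (ε t *_) (sym b-a)))
    where
    t : ℤ
    t = + toℕ k
    difference : ∀ t σ a b → - ((t + σ * a) - (t + σ * b)) ≡ σ * (b - a)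
    difference = solve-∀
    b-a : + (b ℕ.∸ a) ≡ + b - + a
    b-a = trans (sym (ℤ.⊖-≥ (ℕ.<⇒≤ a<b))) (sym (ℤ.m-n≡m⊖n b a))

  -- SwapsGR with the green relation as a parameter, so that it can be transported along yOf n a b ≡ b.
  SwapsWith : (Vtx n → Vtx n → Set) → (Vtx n → Vtx n) → Set
  SwapsWith Gᶜ′ f = ∀ x y → ((Gᶜ′ x y → Rᶜ (f x) (f y)) × (Rᶜ (f x) (f y) → Gᶜ′ x y))
                          × ((Rᶜ x y → Gᶜ′ (f x) (f y)) × (Gᶜ′ (f x) (f y) → Rᶜ x y))

  PreservesEdges : (Vtx n → Vtx n) → Set
  PreservesEdges f = ∀ x y → (Edge n a b x y → Edge n a b (f x) (f y)) × (Edge n a b (f x) (f y) → Edge n a b x y)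

  record Intertwining (f : Vtx n → Vtx n) : Set where
    field
      B-comm : ∀ x → f (B x) ≡ B (f x)
      G-to-R : ∀ x → f (G x) ≡ R (f x)
      R-to-G : ∀ x → f (R x) ≡ G (f x)

  swapping⇒intertwining : ∀ {f} → PreservesEdges f → SwapsWith Gᶜ f → Intertwining f
  swapping⇒intertwining {f} preserves swaps = record
    { B-comm = B-comm ; G-to-R = λ x → R-sound (proj₁ (proj₁ (swaps x (G x))) (G-complete x))
    ; R-to-G = λ x → G-sound (proj₁ (proj₂ (swaps x (R x))) (R-complete x)) }
    where
    B-comm : ∀ x → f (B x) ≡ B (f x)
    B-comm x with edge⇒colour (proj₁ (preserves x (B x)) (Bᶜ⇒edge (B-complete x)))
    ... | inj₁ red           = ⊥-elim (B≢G x (G-sound (proj₂ (proj₁ (swaps x (B x))) red)))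
    ... | inj₂ (inj₁ blue)   = B-sound blue
    ... | inj₂ (inj₂ green)  = ⊥-elim (B≢R x (R-sound (proj₂ (proj₂ (swaps x (B x))) green)))

  intertwining⇒swapping : ∀ {f} → (∀ x → f (f x) ≡ x) → Intertwining f → PreservesEdges f × SwapsWith Gᶜ f
  intertwining⇒swapping {f} f-involutive i = preserves , λ x y → G↔R x y , R↔G x y
    where
    open Intertwining i
    B↔B : ∀ x y → (Bᶜ x y → Bᶜ (f x) (f y)) × (Bᶜ (f x) (f y) → Bᶜ x y)
    B↔B = conjugate-graphs f-involutive B-sound B-complete B-sound B-complete B-comm
    G↔R : ∀ x y → (Gᶜ x y → Rᶜ (f x) (f y)) × (Rᶜ (f x) (f y) → Gᶜ x y)
    G↔R = conjugate-graphs f-involutive G-sound G-complete R-sound R-complete G-to-R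
    R↔G : ∀ x y → (Rᶜ x y → Gᶜ (f x) (f y)) × (Gᶜ (f x) (f y) → Rᶜ x y)
    R↔G = conjugate-graphs f-involutive R-sound R-complete G-sound G-complete R-to-G
    preserves : PreservesEdges f
    preserves x y = forward , backward
      where
      forward : Edge n a b x y → Edge n a b (f x) (f y)
      forward e with edge⇒colour e
      ... | inj₁ red          = Gᶜ⇒edge (proj₁ (R↔G x y) red)
      ... | inj₂ (inj₁ blue)  = Bᶜ⇒edge (proj₁ (B↔B x y) blue)
      ... | inj₂ (inj₂ green) = Rᶜ⇒edge (proj₁ (G↔R x y) green)
      backward : Edge n a b (f x) (f y) → Edge n a b x y
      backward e with edge⇒colour e
      ... | inj₁ red          = Gᶜ⇒edge (proj₂ (G↔R x y) red)
      ... | inj₂ (inj₁ blue)  = Bᶜ⇒edge (proj₂ (B↔B x y) blue)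
      ... | inj₂ (inj₂ green) = Rᶜ⇒edge (proj₂ (R↔G x y) green)

-- Necessity

odd⇒1≤ : ∀ {m} → Odd (+ m) → 1 ℕ.≤ m
odd⇒1≤ {zero}  0-odd = ⊥-elim (¬even∧odd (divides (+ 0) refl) 0-odd)
odd⇒1≤ {suc _} _     = ℕ.s≤s ℕ.z≤n

odd-square⇒odd : ∀ x → Odd (x * x) → Odd x
odd-square⇒odd x o with even⊎odd x
... | inj₁ e  = ⊥-elim (¬even∧odd (∣m⇒∣m*n x e) o)
... | inj₂ o′ = o′

∣-cancel-unit : ∀ {k} x {y} → k ∣ x * x - + 1 → k ∣ x * y → k ∣ y
∣-cancel-unit {k} x {y} k∣x²-1 k∣xy = ∣m∣n⇒∣m-n (∣n⇒∣m*n x k∣xy) (∣m⇒∣m*n y k∣x²-1) ∣≡ solve (x ∷ y ∷ [])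

unique-multiple : ∀ {k m} → 0 ℕ.< m → m ℕ.< k ℕ.+ k → k ℕ.∣ m → m ≡ k
unique-multiple {k} 0<m _ (ℕ.divides zero m≡) = ⊥-elim (ℕ.<⇒≢ 0<m (sym m≡))
unique-multiple {k} _ _ (ℕ.divides (suc zero) m≡) = trans m≡ (ℕ.+-identityʳ k)
unique-multiple {k} _ m<2k (ℕ.divides (suc (suc q)) m≡) =
  ⊥-elim (ℕ.<⇒≱ m<2k (subst (k ℕ.+ k ℕ.≤_) (sym m≡) (ℕ.+-monoʳ-≤ k (ℕ.m≤m+n k (q ℕ.* k)))))

<∸⇒+< : ∀ {x y} c → x ℕ.< y ℕ.∸ c → x ℕ.+ c ℕ.< y
<∸⇒+< {x} {y} c x<y∸c = ℕ.m≤o∸n⇒m+n≤o (suc x) c≤y x<y∸c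
  where
  c≤y : c ℕ.≤ y
  c≤y with ℕ.≤-total c y
  ... | inj₁ c≤y = c≤y
  ... | inj₂ y≤c = ⊥-elim (ℕ.n≮0 (subst (x ℕ.<_) (ℕ.m≤n⇒m∸n≡0 y≤c) x<y∸c))

pos-4a₀+1 : ∀ {a a₀} → a ≡ 4 ℕ.* a₀ ℕ.+ 1 → + a ≡ + 4 * + a₀ + + 1
pos-4a₀+1 {a₀ = a₀} a≡4a₀+1 = trans (cong +_ a≡4a₀+1) (trans (ℤ.pos-+ (4 ℕ.* a₀) 1) (cong (_+ + 1) (ℤ.pos-* 4 a₀)))

4∣a-1⇒a≡4a₀+1 : ∀ {a} → 1 ℕ.≤ a → + 4 ∣ + a - + 1 → Σ ℕ λ a₀ → a ≡ 4 ℕ.* a₀ ℕ.+ 1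
4∣a-1⇒a≡4a₀+1 {a} 1≤a 4∣a-1 with ∣⇒∣ᵤ 4∣a-1
... | ℕ.divides a₀ ∣a-1∣≡a₀*4 = a₀ , (begin
  a                   ≡⟨ sym (ℕ.m∸n+n≡m 1≤a) ⟩
  a ℕ.∸ 1 ℕ.+ 1       ≡⟨ cong (λ m → ∣ m ∣ ℕ.+ 1) (sym (trans (ℤ.m-n≡m⊖n a 1) (ℤ.⊖-≥ 1≤a))) ⟩
  ∣ + a - + 1 ∣ ℕ.+ 1 ≡⟨ cong (ℕ._+ 1) (trans ∣a-1∣≡a₀*4 (ℕ.*-comm a₀ 4)) ⟩
  4 ℕ.* a₀ ℕ.+ 1      ∎)
  where open ≡-Reasoning

record NecessaryConditions (n a : ℕ) : Set where
  field
    k        : ℕ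
    n≡k*4    : n ≡ k ℕ.* 4
    a₀       : ℕ
    a≡4a₀+1  : a ≡ 4 ℕ.* a₀ ℕ.+ 1
    n∣4a₀²-4 : + n ∣ + 4 * + a₀ * + a₀ - + 4

module Necessity (n a b : ℕ) .{{_ : NonZero n}} (n-even : Even (+ n))
                 (a-odd : Odd (+ a)) (b-odd : Odd (+ b)) (2<n : 2 ℕ.< n) (a<b : a ℕ.< b) (b<n : b ℕ.< n) where

  open Colouring n a b n-even a-odd b-odd 2<n a<b b<n

  Q P T T′ : Vtx n → Vtx n
  Q x = B (G x)
  P x = B (R x)
  T x = G (B x)
  T′ x = R (B x)

  Q-u : Alternates Q u u (- + 2)
  Q-u = alternates-∘-odd (divides (- + 1) refl) G-u B-u

  Q-v : Alternates Q v v (+ b - + a)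
  Q-v = alternates-∘-odd b-odd G-v B-v

  T-u : Alternates T u u (+ 2)
  T-u = alternates-∘-odd (divides (+ 0) refl) B-u G-u

  P²-u : Alternates (λ x → P (P x)) u u (+ a - + 1)
  P²-u = alternates-∘-odd a-odd
           (alternates-resp (ℤ.+-identityʳ (+ a)) (alternates-∘-odd a-odd (alternates-∘-even (divides (+ 0) refl) R-u B-v) R-v)) B-u

  1-a-even : Even (+ 1 - + a)
  1-a-even = ∣m⇒∣-m a-odd ∣≡ negate (+ a)
    where
    negate : ∀ a → - (a - + 1) ≡ + 1 - a
    negate = solve-∀

  T′²-u : Alternates (λ x → T′ (T′ x)) u u (+ 1 - + a)
  T′²-u = alternates-resp (ℤ.+-identityʳ (+ 1 - + a))
            (alternates-∘-even 1-a-even (alternates-∘-odd (divides (+ 0) refl) (alternates-∘-odd (divides (+ 0) refl) B-u R-u) B-v) R-v)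

  b-a-even : Even (+ b - + a)
  b-a-even = ∣m∣n⇒∣m-n b-odd a-odd ∣≡ cancel (+ b) (+ a)
    where
    cancel : ∀ b a → (b - + 1) - (a - + 1) ≡ b - a
    cancel = solve-∀

  module Half (h : ℕ) (n≡h*2 : n ≡ h ℕ.* 2) where

    Q^h≡id : ∀ x → fold x Q h ≡ x
    Q^h≡id x = trans (cong (λ y → fold y Q h) (sym (V-toℕ x))) (trans (at (proj₁ x) (+ toℕ (proj₂ x))) (V-toℕ x))
      where
      N≡ : N ≡ + h * + 2
      N≡ = trans (cong +_ n≡h*2) (ℤ.pos-* h 2)
      returns : ∀ s t c e → Even c → c ≡ e * + 2 → Alternates Q s s c → fold (V s t) Q h ≡ V s t
      returns s t c e c-even c≡ Q-alt = trans (fold-alternating c-even Q-alt t h)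
        (V-cong s (t + + h * (ε t * c)) t (divides (ε t * e) (trans (cong (λ c → t + + h * (ε t * c) - t) c≡)
                                                   (trans (regroup t (+ h) (ε t) e) (cong (ε t * e *_) (sym N≡))))))
        where
        regroup : ∀ t h σ e → t + h * (σ * (e * + 2)) - t ≡ σ * e * (h * + 2)
        regroup = solve-∀
      at : ∀ s t → fold (V s t) Q h ≡ V s t
      at u t = returns u t (- + 2) (- + 1) (divides (- + 1) refl) refl Q-u
      at v t = returns v t (+ b - + a) (_∣_.quotient b-a-even) b-a-even (_∣_.equality b-a-even) Q-v

    module _ {f : Vtx n → Vtx n} (f-involutive : ∀ x → f (f x) ≡ x) (f-intertwines : Intertwining f) where

      open Intertwining f-intertwines

      f∘P : ∀ x → f (P x) ≡ Q (f x)
      f∘P x = trans (B-comm (R x)) (cong B (R-to-G x))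

      f∘T : ∀ x → f (T x) ≡ T′ (f x)
      f∘T x = trans (G-to-R (B x)) (cong R (B-comm x))

      u₀ : Vtx n
      u₀ = V u (+ 0)

      P^h-u₀ : fold u₀ P h ≡ u₀
      P^h-u₀ = begin
        fold u₀ P h               ≡⟨ sym (f-involutive _) ⟩
        f (f (fold u₀ P h))       ≡⟨ cong f (fold-conj f f∘P u₀ h) ⟩
        f (fold (f u₀) Q h)       ≡⟨ cong f (Q^h≡id (f u₀)) ⟩
        f (f u₀)                  ≡⟨ f-involutive u₀ ⟩
        u₀                        ∎
        where open ≡-Reasoning

      P²-iterate : ∀ k → fold u₀ P (k ℕ.* 2) ≡ V u (+ 0 + + k * (ε (+ 0) * (+ a - + 1)))
      P²-iterate k = trans (fold-* u₀ P k) (fold-alternating a-odd P²-u (+ 0) k)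

      h-even : Σ ℕ λ k → h ≡ k ℕ.* 2
      h-even with h ℕ.% 2 | ℕ.m%n<n h 2 | ℕ.m≡m%n+[m/n]*n h 2
      ... | 0 | _ | h≡ = h ℕ./ 2 , h≡
      ... | 1 | _ | h≡ = ⊥-elim (v≢u (begin
        v                                          ≡⟨⟩
        proj₁ (P (V u (+ 0 + + (h ℕ./ 2) * (ε (+ 0) * (+ a - + 1))))) ≡⟨ cong (λ x → proj₁ (P x)) (sym (P²-iterate (h ℕ./ 2))) ⟩
        proj₁ (fold u₀ P (suc (h ℕ./ 2 ℕ.* 2)))    ≡⟨ cong (λ m → proj₁ (fold u₀ P m)) (sym h≡) ⟩
        proj₁ (fold u₀ P h)                        ≡⟨ cong proj₁ P^h-u₀ ⟩
        u                                          ∎))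
        where
        open ≡-Reasoning
        v≢u : v ≢ u
        v≢u ()
      ... | suc (suc _) | ℕ.s≤s (ℕ.s≤s ()) | _

      module Quarter (k : ℕ) (h≡k*2 : h ≡ k ℕ.* 2) where

        n≡k*4 : n ≡ k ℕ.* 4
        n≡k*4 = trans n≡h*2 (trans (cong (ℕ._* 2) h≡k*2) (ℕ.*-assoc k 2 2))

        N≡k*4 : N ≡ + k * + 4
        N≡k*4 = trans (cong +_ n≡k*4) (ℤ.pos-* k 4)

        k≢0 : k ≢ 0
        k≢0 k≡0 = ℕ.≢-nonZero⁻¹ n (ℤ.+-injective (trans N≡k*4 (cong (λ k → + k * + 4) k≡0)))

        4∣a-1 : + 4 ∣ + a - + 1
        4∣a-1 = *-cancelˡ-∣ (+ k) {{ℕ.≢-nonZero k≢0}} (subst (_∣ + k * (+ a - + 1)) N≡k*4 (N∣ ∣≡ simplify (+ k) (+ a)))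
          where
          N∣ : N ∣ + 0 + + k * (ε (+ 0) * (+ a - + 1)) - + 0
          N∣ = V-injective u (+ 0 + + k * (ε (+ 0) * (+ a - + 1))) (+ 0) (trans (sym (P²-iterate k)) (trans (cong (fold u₀ P) (sym h≡k*2)) P^h-u₀))
          simplify : ∀ k a → + 0 + k * (+ 1 * (a - + 1)) - + 0 ≡ k * (a - + 1)
          simplify = solve-∀

        module Shape (a₀ : ℕ) (a≡4a₀+1 : a ≡ 4 ℕ.* a₀ ℕ.+ 1) where

          A₀ : ℤ
          A₀ = + a₀

          a≡4A₀+1 : + a ≡ + 4 * A₀ + + 1
          a≡4A₀+1 = pos-4a₀+1 {a} {a₀} a≡4a₀+1

          T^2a₀≡P² : ∀ e → Even e → fold (V u e) T (a₀ ℕ.* 2) ≡ P (P (V u e))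
          T^2a₀≡P² e e-even = begin
            fold (V u e) T (a₀ ℕ.* 2)              ≡⟨ fold-alternating (divides (+ 1) refl) T-u e (a₀ ℕ.* 2) ⟩
            V u (e + + (a₀ ℕ.* 2) * (ε e * + 2))   ≡⟨ cong (V u) (same-shift (ε-even e e-even)) ⟩
            V u (e + ε e * (+ a - + 1))            ≡⟨ sym (step P²-u e) ⟩
            P (P (V u e))                          ∎
            where
            open ≡-Reasoning
            regroup : ∀ e a₀ → e + a₀ * + 2 * (+ 1 * + 2) ≡ e + + 1 * (+ 4 * a₀ + + 1 - + 1)
            regroup = solve-∀
            same-shift : ε e ≡ + 1 → e + + (a₀ ℕ.* 2) * (ε e * + 2) ≡ e + ε e * (+ a - + 1)
            same-shift ε≡1 = trans (cong₂ (λ x σ → e + x * (σ * + 2)) (ℤ.pos-* a₀ 2) ε≡1)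
                                   (trans (regroup e A₀) (cong₂ (λ σ α → e + σ * (α - + 1)) (sym ε≡1) (sym a≡4A₀+1)))

          T′^2a₀≡Q² : ∀ x → (∃ λ e → Even e × f (V u e) ≡ x) → fold x T′ (a₀ ℕ.* 2) ≡ Q (Q x)
          T′^2a₀≡Q² x (e , e-even , refl) = begin
            fold (f (V u e)) T′ (a₀ ℕ.* 2)    ≡⟨ sym (fold-conj f f∘T (V u e) (a₀ ℕ.* 2)) ⟩
            f (fold (V u e) T (a₀ ℕ.* 2))     ≡⟨ cong f (T^2a₀≡P² e e-even) ⟩
            f (P (P (V u e)))                 ≡⟨ f∘P (P (V u e)) ⟩
            Q (f (P (V u e)))                 ≡⟨ cong Q (f∘P (V u e)) ⟩
            Q (Q (f (V u e)))                 ∎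
            where open ≡-Reasoning

          -- At u_j the two sides of T′^(2a₀) = Q² move j by ε j · a₀(1 - a) and by ε j · (-4).
          N∣4A₀²-4-at : ∀ j → (∃ λ e → Even e × f (V u e) ≡ V u j) → N ∣ + 4 * A₀ * A₀ - + 4
          N∣4A₀²-4-at j image = ∣m⇒∣-m (∣ε*⇒∣ j (N∣ ∣≡ difference)) ∣≡ negate (+ 4 * A₀ * A₀)
            where
            open ≡-Reasoning
            N∣ : N ∣ (j + + a₀ * (ε j * (+ 1 - + a))) - (j + + 2 * (ε j * - + 2))
            N∣ = V-injective u (j + + a₀ * (ε j * (+ 1 - + a))) (j + + 2 * (ε j * - + 2)) (begin
              V u (j + + a₀ * (ε j * (+ 1 - + a)))   ≡⟨ sym (fold-alternating 1-a-even T′²-u j a₀) ⟩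
              fold (V u j) (λ x → T′ (T′ x)) a₀      ≡⟨ sym (fold-* (V u j) T′ a₀) ⟩
              fold (V u j) T′ (a₀ ℕ.* 2)             ≡⟨ T′^2a₀≡Q² (V u j) image ⟩
              fold (V u j) Q 2                       ≡⟨ fold-alternating (divides (- + 1) refl) Q-u j 2 ⟩
              V u (j + + 2 * (ε j * - + 2))          ∎)
            regroup : ∀ j σ a₀ → (j + a₀ * (σ * (+ 1 - (+ 4 * a₀ + + 1)))) - (j + + 2 * (σ * - + 2)) ≡ σ * (+ 4 - + 4 * a₀ * a₀)
            regroup = solve-∀
            difference : (j + + a₀ * (ε j * (+ 1 - + a))) - (j + + 2 * (ε j * - + 2)) ≡ ε j * (+ 4 - + 4 * A₀ * A₀)
            difference = trans (cong (λ α → (j + A₀ * (ε j * (+ 1 - α))) - (j + + 2 * (ε j * - + 2))) a≡4A₀+1)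
                               (regroup j (ε j) A₀)
            negate : ∀ x → - (+ 4 - x) ≡ x - + 4
            negate = solve-∀

          -- f u₀ is a u-vertex, or else f u₂ = T′ (f u₀) is one.
          n∣4a₀²-4 : N ∣ + 4 * A₀ * A₀ - + 4
          n∣4a₀²-4 with f u₀ in fu₀≡
          ... | u , k = N∣4A₀²-4-at (+ toℕ k) (+ 0 , divides (+ 0) refl , trans fu₀≡ (sym (V-toℕ (u , k))))
          ... | v , k = N∣4A₀²-4-at (+ toℕ k′) (+ 2 , divides (+ 1) refl , trans fu₂≡ (sym (V-toℕ (u , k′))))
            where
            k′ : Fin n
            k′ = proj₂ (R (B (v , k)))
            fu₂≡ : f (V u (+ 2)) ≡ (u , k′)
            fu₂≡ = trans (cong f (sym (step T-u (+ 0)))) (trans (f∘T u₀) (cong (λ x → R (B x)) fu₀≡))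

  necessary : ∀ {f} → (∀ x → f (f x) ≡ x) → Intertwining f → NecessaryConditions n a
  necessary f-involutive f-intertwines with ∣⇒∣ᵤ n-even
  ... | ℕ.divides h n≡h*2 with Half.h-even h n≡h*2 f-involutive f-intertwines
  ... | k , h≡k*2 with 4∣a-1⇒a≡4a₀+1 (odd⇒1≤ a-odd) (Half.Quarter.4∣a-1 h n≡h*2 f-involutive f-intertwines k h≡k*2)
  ... | a₀ , a≡4a₀+1 = record
    { k = k ; n≡k*4 = Half.Quarter.n≡k*4 h n≡h*2 f-involutive f-intertwines k h≡k*2
    ; a₀ = a₀ ; a≡4a₀+1 = a≡4a₀+1
    ; n∣4a₀²-4 = Half.Quarter.Shape.n∣4a₀²-4 h n≡h*2 f-involutive f-intertwines k h≡k*2 a₀ a≡4a₀+1 }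

module Arithmetic (n a b : ℕ) .{{_ : NonZero n}} (b-odd : Odd (+ b)) (a+2<b : a ℕ.+ 2 ℕ.< b) (b<n : b ℕ.< n)
                  (square : ((b ℕ.∸ a) ℕ.* (b ℕ.∸ a) ℕ./ 2) ℕ.% n ≡ 2 ℕ.% n) (congX : CongX n a b)
                  (bound : b ℕ.∸ 2 ℕ.< n ℕ.∸ a ℕ.∸ 2) (nec : NecessaryConditions n a) where

  open NecessaryConditions nec
  open Indices n using (N; N∣⇒%ℕ≡; %ℕ≡⇒N∣)

  K A₀ : ℤ
  K = + k
  A₀ = + a₀

  N≡4K : N ≡ + 4 * K
  N≡4K = trans (cong +_ (trans n≡k*4 (ℕ.*-comm k 4))) (ℤ.pos-* 4 k)

  a≡4A₀+1 : + a ≡ + 4 * A₀ + + 1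
  a≡4A₀+1 = pos-4a₀+1 {a} {a₀} a≡4a₀+1

  a-odd : Odd (+ a)
  a-odd = divides (+ 2 * A₀) (trans (cong (_- + 1) a≡4A₀+1) (regroup A₀))
    where
    regroup : ∀ x → + 4 * x + + 1 - + 1 ≡ + 2 * x * + 2
    regroup = solve-∀

  a<b : a ℕ.< b
  a<b = ℕ.<-trans (ℕ.m<m+n a (ℕ.s≤s ℕ.z≤n)) a+2<b

  b-a-even : Even (+ b - + a)
  b-a-even = ∣m∣n⇒∣m-n b-odd a-odd ∣≡ cancel (+ b) (+ a)
    where
    cancel : ∀ b a → (b - + 1) - (a - + 1) ≡ b - a
    cancel = solve-∀

  b-a≡b∸a : + b - + a ≡ + (b ℕ.∸ a)
  b-a≡b∸a = trans (ℤ.m-n≡m⊖n b a) (ℤ.⊖-≥ (ℕ.<⇒≤ a<b))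

  4K∣4x⇒K∣x : ∀ {x} → N ∣ + 4 * x → K ∣ x
  4K∣4x⇒K∣x N∣ = *-cancelˡ-∣ (+ 4) (subst (_∣ _) N≡4K N∣)

  K∣A₀²-1 : K ∣ A₀ * A₀ - + 1
  K∣A₀²-1 = 4K∣4x⇒K∣x (n∣4a₀²-4 ∣≡ factor A₀)
    where
    factor : ∀ x → + 4 * x * x - + 4 ≡ + 4 * (x * x - + 1)
    factor = solve-∀

  module _ (d : ℕ) (b∸a≡d*2 : b ℕ.∸ a ≡ d ℕ.* 2) where

    D : ℤ
    D = + d

    b≡a+2D : + b ≡ + a + + 2 * D
    b≡a+2D = begin
      + b                     ≡⟨ cong +_ (sym (ℕ.m+[n∸m]≡n (ℕ.<⇒≤ a<b))) ⟩
      + (a ℕ.+ (b ℕ.∸ a))     ≡⟨ ℤ.pos-+ a (b ℕ.∸ a) ⟩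
      + a + + (b ℕ.∸ a)       ≡⟨ cong (λ m → + a + + m) b∸a≡d*2 ⟩
      + a + + (d ℕ.* 2)       ≡⟨ cong (λ x → + a + x) (trans (ℤ.pos-* d 2) (ℤ.*-comm D (+ 2))) ⟩
      + a + + 2 * D           ∎
      where open ≡-Reasoning

    N∣2D²-2 : N ∣ + 2 * (D * D) - + 2
    N∣2D²-2 = %ℕ≡⇒N∣ (+ (d ℕ.* d ℕ.* 2)) (+ 2) (trans (cong (ℕ._% n) (sym half-square)) square)
                ∣≡ cong (_- + 2) (trans (ℤ.pos-* (d ℕ.* d) 2) (trans (cong (_* + 2) (ℤ.pos-* d d)) (ℤ.*-comm (D * D) (+ 2))))
      where
      regroup : ∀ d → d ℕ.* 2 ℕ.* (d ℕ.* 2) ≡ d ℕ.* d ℕ.* 2 ℕ.* 2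
      regroup = ℕ-Solver.solve-∀
      half-square : (b ℕ.∸ a) ℕ.* (b ℕ.∸ a) ℕ./ 2 ≡ d ℕ.* d ℕ.* 2
      half-square = trans (cong (λ m → m ℕ.* m ℕ./ 2) b∸a≡d*2) (trans (cong (ℕ._/ 2) (regroup d)) (ℕ.m*n/n≡m (d ℕ.* d ℕ.* 2) 2))

    D-odd : Odd D
    D-odd = odd-square⇒odd D (∣-trans (∣m⇒∣m*n K ∣-refl) (*-cancelˡ-∣ (+ 2) (subst (_∣ + 2 * (D * D - + 1)) N≡2[2K] (N∣2D²-2 ∣≡ factor D))))
      where
      N≡2[2K] : N ≡ + 2 * (+ 2 * K)
      N≡2[2K] = trans N≡4K (regroup K)
        where
        regroup : ∀ x → + 4 * x ≡ + 2 * (+ 2 * x)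
        regroup = solve-∀
      factor : ∀ x → + 2 * (x * x) - + 2 ≡ + 2 * (x * x - + 1)
      factor = solve-∀

    -- With a = 4a₀ + 1 and b = a + 2d, the congruence CongX n a b reads 4a₀(1 - d) ≡ 0 (mod n).
    K∣A₀[1-D] : K ∣ A₀ * (+ 1 - D)
    K∣A₀[1-D] = 4K∣4x⇒K∣x (∣ᵤ⇒∣ congX ∣≡ (begin
      + a + + ((a ℕ.∸ 1) ℕ./ 2) * (+ a - + b) - + 1       ≡⟨ cong (λ h → + a + h * (+ a - + b) - + 1) half-a-1 ⟩
      + a + A₀ * + 2 * (+ a - + b) - + 1                  ≡⟨ cong (λ β → + a + A₀ * + 2 * (+ a - β) - + 1) b≡a+2D ⟩
      + a + A₀ * + 2 * (+ a - (+ a + + 2 * D)) - + 1      ≡⟨ cong (λ α → α + A₀ * + 2 * (α - (α + + 2 * D)) - + 1) a≡4A₀+1 ⟩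
      (+ 4 * A₀ + + 1) + A₀ * + 2 * ((+ 4 * A₀ + + 1) - ((+ 4 * A₀ + + 1) + + 2 * D)) - + 1
                                                          ≡⟨ regroup A₀ D ⟩
      + 4 * (A₀ * (+ 1 - D))                              ∎))
      where
      open ≡-Reasoning
      regroup : ∀ x y → (+ 4 * x + + 1) + x * + 2 * ((+ 4 * x + + 1) - ((+ 4 * x + + 1) + + 2 * y)) - + 1 ≡ + 4 * (x * (+ 1 - y))
      regroup = solve-∀
      half-a-1 : + ((a ℕ.∸ 1) ℕ./ 2) ≡ A₀ * + 2
      half-a-1 = trans (cong (λ m → + ((m ℕ.∸ 1) ℕ./ 2)) a≡4a₀+1)
                       (trans (cong (λ m → + (m ℕ./ 2)) (trans (ℕ.m+n∸n≡m (4 ℕ.* a₀) 1) (regroup′ a₀)))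
                              (trans (cong +_ (ℕ.m*n/n≡m (a₀ ℕ.* 2) 2)) (ℤ.pos-* a₀ 2)))
        where
        regroup′ : ∀ x → 4 ℕ.* x ≡ x ℕ.* 2 ℕ.* 2
        regroup′ = ℕ-Solver.solve-∀

    K∣D-1 : K ∣ D - + 1
    K∣D-1 = ∣m⇒∣-m (∣-cancel-unit A₀ K∣A₀²-1 K∣A₀[1-D]) ∣≡ negate D
      where
      negate : ∀ x → - (+ 1 - x) ≡ x - + 1
      negate = solve-∀

    1<d : 1 ℕ.< d
    1<d = ℕ.*-cancelʳ-< 2 1 d (subst (2 ℕ.<_) b∸a≡d*2 (ℕ.+-cancelˡ-< a 2 (b ℕ.∸ a) (subst (a ℕ.+ 2 ℕ.<_) (sym (ℕ.m+[n∸m]≡n (ℕ.<⇒≤ a<b))) a+2<b)))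

    d<k+k : d ℕ.< k ℕ.+ k
    d<k+k = ℕ.*-cancelʳ-< 2 d (k ℕ.+ k) (subst₂ ℕ._<_ b∸a≡d*2 (trans n≡k*4 (regroup k)) (ℕ.≤-<-trans (ℕ.m∸n≤m b a) b<n))
      where
      regroup : ∀ k → k ℕ.* 4 ≡ (k ℕ.+ k) ℕ.* 2
      regroup = ℕ-Solver.solve-∀

    d≡k+1 : d ≡ k ℕ.+ 1
    d≡k+1 = trans (sym (ℕ.m∸n+n≡m (ℕ.<⇒≤ 1<d)))
                  (cong (ℕ._+ 1) (unique-multiple (ℕ.m<n⇒0<n∸m 1<d) (ℕ.≤-<-trans (ℕ.m∸n≤m d 1) d<k+k) k∣d-1))
      where
      k∣d-1 : k ℕ.∣ d ℕ.∸ 1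
      k∣d-1 = subst (k ℕ.∣_) (cong ∣_∣ (trans (ℤ.m-n≡m⊖n d 1) (ℤ.⊖-≥ (ℕ.<⇒≤ 1<d)))) (∣⇒∣ᵤ K∣D-1)

    k-even : 2 ℕ.∣ k
    k-even = ∣⇒∣ᵤ {+ 2} {K} (D-odd ∣≡ cong (λ m → + m - + 1) d≡k+1 ∣≡ drop1 K)
      where
      drop1 : ∀ x → x + + 1 - + 1 ≡ x
      drop1 = solve-∀

    8∣n : 8 ℕ.∣ n
    8∣n = ℕ.divides m (trans n≡k*4 (trans (cong (ℕ._* 4) (ℕ._∣_.equality k-even)) (ℕ.*-assoc m 2 4)))
      where
      m : ℕ
      m = ℕ._∣_.quotient k-even

    a₀-odd : ¬ (2 ℕ.∣ a₀)
    a₀-odd 2∣a₀ = ¬even∧odd (∣ᵤ⇒∣ {+ 2} {A₀} 2∣a₀) (odd-square⇒odd A₀ (∣-trans (∣ᵤ⇒∣ {+ 2} {K} k-even) K∣A₀²-1))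

    b≡a+[k+1]*2 : b ≡ a ℕ.+ (k ℕ.+ 1) ℕ.* 2
    b≡a+[k+1]*2 = trans (sym (ℕ.m+[n∸m]≡n (ℕ.<⇒≤ a<b))) (cong (a ℕ.+_) (trans b∸a≡d*2 (cong (ℕ._* 2) d≡k+1)))

    b≡n/2+a+2 : b ≡ n ℕ./ 2 ℕ.+ a ℕ.+ 2
    b≡n/2+a+2 = trans b≡a+[k+1]*2 (trans (regroup a k) (cong (λ h → h ℕ.+ a ℕ.+ 2) (sym n/2≡k*2)))
      where
      regroup : ∀ a k → a ℕ.+ (k ℕ.+ 1) ℕ.* 2 ≡ k ℕ.* 2 ℕ.+ a ℕ.+ 2
      regroup = ℕ-Solver.solve-∀
      n/2≡k*2 : n ℕ./ 2 ≡ k ℕ.* 2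
      n/2≡k*2 = trans (cong (ℕ._/ 2) (trans n≡k*4 (sym (ℕ.*-assoc k 2 2)))) (ℕ.m*n/n≡m (k ℕ.* 2) 2)

    -- b - 2 < n - a - 2 says b + a < n, that is 2a + 2 < 2k.
    4a+4<n : 4 ℕ.* a ℕ.+ 4 ℕ.< n
    4a+4<n = subst₂ ℕ._<_ (regroup a) (sym (trans n≡k*4 (regroup′ k))) (ℕ.+-mono-< 2a+2<2k 2a+2<2k)
      where
      regroup : ∀ a → a ℕ.+ a ℕ.+ 2 ℕ.+ (a ℕ.+ a ℕ.+ 2) ≡ 4 ℕ.* a ℕ.+ 4
      regroup = ℕ-Solver.solve-∀
      regroup′ : ∀ k → k ℕ.* 4 ≡ k ℕ.+ k ℕ.+ (k ℕ.+ k)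
      regroup′ = ℕ-Solver.solve-∀
      regroup″ : ∀ a k → a ℕ.+ (k ℕ.+ 1) ℕ.* 2 ℕ.+ a ≡ a ℕ.+ a ℕ.+ 2 ℕ.+ (k ℕ.+ k)
      regroup″ = ℕ-Solver.solve-∀
      b+a<n : b ℕ.+ a ℕ.< n
      b+a<n = <∸⇒+< a (subst (ℕ._< n ℕ.∸ a) (ℕ.m∸n+n≡m (ℕ.≤-trans (ℕ.m≤n+m 2 a) (ℕ.<⇒≤ a+2<b))) (<∸⇒+< 2 bound))
      2a+2<2k : a ℕ.+ a ℕ.+ 2 ℕ.< k ℕ.+ k
      2a+2<2k = ℕ.+-cancelʳ-< (k ℕ.+ k) (a ℕ.+ a ℕ.+ 2) (k ℕ.+ k)
        (subst₂ ℕ._<_ (trans (cong (ℕ._+ a) b≡a+[k+1]*2) (regroup″ a k)) (trans n≡k*4 (regroup′ k)) b+a<n)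

  characterisation : Characterisation n a b
  characterisation =
    8∣n d b∸a≡d*2 , (a₀ , a≡4a₀+1 , 4a+4<n d b∸a≡d*2 , a₀-odd d b∸a≡d*2 , 4a₀²≡4) , b≡n/2+a+2 d b∸a≡d*2
    where
    d : ℕ
    d = ℕ._∣_.quotient (∣⇒∣ᵤ b-a-even)
    b∸a≡d*2 : b ℕ.∸ a ≡ d ℕ.* 2
    b∸a≡d*2 = trans (cong ∣_∣ (sym b-a≡b∸a)) (ℕ._∣_.equality (∣⇒∣ᵤ b-a-even))
    4a₀²≡4 : (4 ℕ.* a₀ ℕ.* a₀) ℕ.% n ≡ 4 ℕ.% n
    4a₀²≡4 = N∣⇒%ℕ≡ (+ (4 ℕ.* a₀ ℕ.* a₀)) (+ 4)
               (n∣4a₀²-4 ∣≡ cong (_- + 4) (sym (trans (ℤ.pos-* (4 ℕ.* a₀) a₀) (cong (_* A₀) (ℤ.pos-* 4 a₀)))))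

-- Sufficiency

module ResidueClasses (n : ℕ) .{{_ : NonZero n}} (Q : ℤ) (N≡4Q : + n ≡ + 4 * Q) where

  open Indices n

  Class : Set
  Class = Side × Fin 4

  at : Class → ℤ → Vtx n
  at (s , r) K = V s (+ 4 * K + + toℕ r)

  at-cong : ∀ c K K′ → Q ∣ K - K′ → at c K ≡ at c K′
  at-cong (s , r) K K′ (divides q K-K′≡) = V-cong s (+ 4 * K + + toℕ r) (+ 4 * K′ + + toℕ r) (divides q (begin
    (+ 4 * K + + toℕ r) - (+ 4 * K′ + + toℕ r)   ≡⟨ regroup K K′ (+ toℕ r) ⟩
    + 4 * (K - K′)                               ≡⟨ cong (+ 4 *_) K-K′≡ ⟩
    + 4 * (q * Q)                                ≡⟨ regroup′ q Q ⟩
    q * (+ 4 * Q)                                ≡⟨ cong (q *_) (sym N≡4Q) ⟩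
    q * N                                        ∎))
    where
    open ≡-Reasoning
    regroup : ∀ K K′ r → (+ 4 * K + r) - (+ 4 * K′ + r) ≡ + 4 * (K - K′)
    regroup = solve-∀
    regroup′ : ∀ q Q → + 4 * (q * Q) ≡ q * (+ 4 * Q)
    regroup′ = solve-∀

  residue : Fin n → Fin 4
  residue k = fromℕ< (ℕ.m%n<n (toℕ k) 4)

  quotient : Fin n → ℤ
  quotient k = + (toℕ k ℕ./ 4)

  at-residue : ∀ s k → at (s , residue k) (quotient k) ≡ (s , k)
  at-residue s k = trans (cong (V s) (begin
    + 4 * + (t ℕ./ 4) + + toℕ (residue k)   ≡⟨ cong (λ r → + 4 * + (t ℕ./ 4) + + r) (Fin.toℕ-fromℕ< (ℕ.m%n<n t 4)) ⟩
    + 4 * + (t ℕ./ 4) + + (t ℕ.% 4)         ≡⟨ sym (trans (cong +_ (trans (ℕ.m≡m%n+[m/n]*n t 4) (ℕ.+-comm (t ℕ.% 4) _))) (trans (ℤ.pos-+ (t ℕ./ 4 ℕ.* 4) _) (cong (_+ + (t ℕ.% 4)) (trans (ℤ.pos-* (t ℕ./ 4) 4) (ℤ.*-comm (+ (t ℕ./ 4)) (+ 4)))))) ⟩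
    + t                                      ∎)) (V-toℕ (s , k))
    where
    open ≡-Reasoning
    t : ℕ
    t = toℕ k

  record Affine (F : Vtx n → Vtx n) : Set where
    field
      target : Class → Class
      slope  : ℤ
      offset : Class → ℤ
      law    : ∀ c K → F (at c K) ≡ at (target c) (K * slope + offset c)

  open Affine

  id-affine : Affine (λ x → x)
  id-affine = record { target = λ c → c ; slope = + 1 ; offset = λ _ → + 0
                     ; law = λ c K → cong (at c) (regroup K) }
    where
    regroup : ∀ K → K ≡ K * + 1 + + 0
    regroup = solve-∀

  ∘-affine : ∀ {F H} → Affine F → Affine H → Affine (λ x → H (F x))
  ∘-affine {F} {H} AF AH = record
    { target = λ c → target AH (target AF c)
    ; slope  = slope AF * slope AH
    ; offset = λ c → offset AF c * slope AH + offset AH (target AF c)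
    ; law    = λ c K → begin
        H (F (at c K))                                              ≡⟨ cong H (law AF c K) ⟩
        H (at (target AF c) (K * slope AF + offset AF c))           ≡⟨ law AH (target AF c) (K * slope AF + offset AF c) ⟩
        at _ ((K * slope AF + offset AF c) * slope AH + offset AH (target AF c))
                                                                    ≡⟨ cong (at _) (regroup K (slope AF) (offset AF c) (slope AH) _) ⟩
        at _ (K * (slope AF * slope AH) + (offset AF c * slope AH + offset AH (target AF c))) ∎ }
    where
    open ≡-Reasoning
    regroup : ∀ K s o s′ o′ → (K * s + o) * s′ + o′ ≡ K * (s * s′) + (o * s′ + o′)
    regroup = solve-∀

  at-surjective : ∀ x → Σ Class λ c → Σ ℤ λ K → at c K ≡ x
  at-surjective (s , k) = (s , residue k) , quotient k , at-residue s k

  affine-≗ : ∀ {F H} (AF : Affine F) (AH : Affine H) → (∀ c → target AF c ≡ target AH c) →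
             Q ∣ slope AF - slope AH → (∀ c → Q ∣ offset AF c - offset AH c) → ∀ x → F x ≡ H x
  affine-≗ {F} {H} AF AH same-target Q∣slopes Q∣offsets x with at-surjective x
  ... | c , K , refl = begin
    F (at c K)                                      ≡⟨ law AF c K ⟩
    at (target AF c) (K * slope AF + offset AF c)   ≡⟨ cong (λ d → at d (K * slope AF + offset AF c)) (same-target c) ⟩
    at (target AH c) (K * slope AF + offset AF c)   ≡⟨ at-cong (target AH c) (K * slope AF + offset AF c) (K * slope AH + offset AH c) (∣m∣n⇒∣m+n (∣n⇒∣m*n K Q∣slopes) (Q∣offsets c) ∣≡ regroup K (slope AF) (slope AH) (offset AF c) (offset AH c)) ⟩
    at (target AH c) (K * slope AH + offset AH c)   ≡⟨ sym (law AH c K) ⟩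
    H (at c K)                                      ∎
    where
    open ≡-Reasoning
    regroup : ∀ K s s′ o o′ → K * (s - s′) + (o - o′) ≡ (K * s + o) - (K * s′ + o′)
    regroup = solve-∀

  by-class : {P : Class → Set} → P (u , 0F) → P (u , 1F) → P (u , 2F) → P (u , 3F) →
                                  P (v , 0F) → P (v , 1F) → P (v , 2F) → P (v , 3F) → ∀ c → P c
  by-class pu0 pu1 pu2 pu3 pv0 pv1 pv2 pv3 (u , 0F) = pu0
  by-class pu0 pu1 pu2 pu3 pv0 pv1 pv2 pv3 (u , 1F) = pu1
  by-class pu0 pu1 pu2 pu3 pv0 pv1 pv2 pv3 (u , 2F) = pu2
  by-class pu0 pu1 pu2 pu3 pv0 pv1 pv2 pv3 (u , 3F) = pu3
  by-class pu0 pu1 pu2 pu3 pv0 pv1 pv2 pv3 (v , 0F) = pv0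
  by-class pu0 pu1 pu2 pu3 pv0 pv1 pv2 pv3 (v , 1F) = pv1
  by-class pu0 pu1 pu2 pu3 pv0 pv1 pv2 pv3 (v , 2F) = pv2
  by-class pu0 pu1 pu2 pu3 pv0 pv1 pv2 pv3 (v , 3F) = pv3

  private
    4∣N : + 4 ∣ N
    4∣N = divides Q (trans N≡4Q (ℤ.*-comm (+ 4) Q))

  at-injective : ∀ {s r r′ K K′} → at (s , r) K ≡ at (s , r′) K′ → r ≡ r′ × Q ∣ K - K′
  at-injective {s} {r} {r′} {K} {K′} eq = r≡r′ , *-cancelˡ-∣ (+ 4) (subst (_∣ + 4 * (K - K′)) N≡4Q
    (N∣ ∣≡ trans (cong (λ ρ → (+ 4 * K + + toℕ r) - (+ 4 * K′ + + toℕ ρ)) (sym r≡r′)) (regroup K K′ (+ toℕ r))))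
    where
    N∣ : N ∣ (+ 4 * K + + toℕ r) - (+ 4 * K′ + + toℕ r′)
    N∣ = V-injective s (+ 4 * K + + toℕ r) (+ 4 * K′ + + toℕ r′) eq
    regroup : ∀ K K′ ρ → (+ 4 * K + ρ) - (+ 4 * K′ + ρ) ≡ + 4 * (K - K′)
    regroup = solve-∀
    regroup′ : ∀ K K′ ρ ρ′ → ((+ 4 * K + ρ) - (+ 4 * K′ + ρ′)) - + 4 * (K - K′) ≡ ρ - ρ′
    regroup′ = solve-∀
    r≡r′ : r ≡ r′
    r≡r′ = Fin.toℕ-injective (Indices.residue-unique 4 (Fin.toℕ<n r) (Fin.toℕ<n r′)
             (∣m∣n⇒∣m-n (∣-trans 4∣N N∣) (∣m⇒∣m*n (K - K′) ∣-refl) ∣≡ regroup′ K K′ (+ toℕ r) (+ toℕ r′)))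

  open Alternating n

  class-step : ∀ {F s s′ c} → Alternates F s s′ c → ∀ r {r′} K o →
               ε (+ toℕ r) * c ≡ + 4 * o + + toℕ r′ - + toℕ r → F (at (s , r) K) ≡ at (s′ , r′) (K * + 1 + o)
  class-step {F} {s} {s′} {c} F-alt r {r′} K o step≡ = begin
    F (V s (+ 4 * K + ρ))                        ≡⟨ step F-alt (+ 4 * K + ρ) ⟩
    V s′ (+ 4 * K + ρ + ε (+ 4 * K + ρ) * c)  ≡⟨ cong (λ σ → V s′ (+ 4 * K + ρ + σ * c)) (ε-cong (+ 4 * K + ρ) ρ (divides (+ 2 * K) (regroup K ρ))) ⟩
    V s′ (+ 4 * K + ρ + ε ρ * c)              ≡⟨ cong (λ x → V s′ (+ 4 * K + ρ + x)) step≡ ⟩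
    V s′ (+ 4 * K + ρ + (+ 4 * o + ρ′ - ρ))      ≡⟨ cong (V s′) (regroup′ K ρ o ρ′) ⟩
    V s′ (+ 4 * (K * + 1 + o) + ρ′)              ∎
    where
    open ≡-Reasoning
    ρ ρ′ : ℤ
    ρ = + toℕ r
    ρ′ = + toℕ r′
    regroup : ∀ K ρ → + 4 * K + ρ - ρ ≡ + 2 * K * + 2
    regroup = solve-∀
    regroup′ : ∀ K ρ o ρ′ → + 4 * K + ρ + (+ 4 * o + ρ′ - ρ) ≡ + 4 * (K * + 1 + o) + ρ′
    regroup′ = solve-∀

module Sufficiency (n a b : ℕ) .{{_ : NonZero n}} (n-even : Even (+ n)) (a-odd : Odd (+ a)) (b-odd : Odd (+ b))
                   (2<n : 2 ℕ.< n) (a<b : a ℕ.< b) (b<n : b ℕ.< n)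
                   (M A₀ C : ℤ) (N≡8M : + n ≡ + 8 * M) (A₀≡2C+1 : A₀ ≡ + 2 * C + + 1)
                   (a≡4A₀+1 : + a ≡ + 4 * A₀ + + 1) (b≡4[M+A₀]+3 : + b ≡ + 4 * (M + A₀) + + 3)
                   (2M∣A₀²-1 : + 2 * M ∣ A₀ * A₀ - + 1) where

  open Colouring n a b n-even a-odd b-odd 2<n a<b b<n

  N≡4[2M] : + n ≡ + 4 * (+ 2 * M)
  N≡4[2M] = trans N≡8M (regroup M)
    where
    regroup : ∀ M → + 8 * M ≡ + 4 * (+ 2 * M)
    regroup = solve-∀

  open ResidueClasses n (+ 2 * M) N≡4[2M]
  open Affine

  B-affine : Affine B
  B-affine = record { target = target′ ; slope = + 1 ; offset = offset′ ; law = law′ }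
    where
    target′ : Class → Class
    target′ (s , 0F) = s , 1F
    target′ (s , 1F) = s , 0F
    target′ (s , 2F) = s , 3F
    target′ (s , 3F) = s , 2F
    offset′ : Class → ℤ
    offset′ (u , _)  = + 0
    offset′ (v , 0F) = A₀
    offset′ (v , 1F) = - A₀
    offset′ (v , 2F) = A₀
    offset′ (v , 3F) = - A₀
    B-v′ : Alternates B v v (+ 4 * A₀ + + 1)
    B-v′ = alternates-resp a≡4A₀+1 B-v
    forward : ∀ x r → + 1 * (+ 4 * x + + 1) ≡ + 4 * x + (r + + 1) - r
    forward = solve-∀
    backward : ∀ x r → - + 1 * (+ 4 * x + + 1) ≡ + 4 * (- x) + (r - + 1) - r
    backward = solve-∀
    law′ : ∀ c K → B (at c K) ≡ at (target′ c) (K * + 1 + offset′ c)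
    law′ (u , 0F) K = class-step B-u 0F K (+ 0) refl
    law′ (u , 1F) K = class-step B-u 1F K (+ 0) refl
    law′ (u , 2F) K = class-step B-u 2F K (+ 0) refl
    law′ (u , 3F) K = class-step B-u 3F K (+ 0) refl
    law′ (v , 0F) K = class-step B-v′ 0F K A₀ (forward A₀ (+ 0))
    law′ (v , 1F) K = class-step B-v′ 1F K (- A₀) (backward A₀ (+ 1))
    law′ (v , 2F) K = class-step B-v′ 2F K A₀ (forward A₀ (+ 2))
    law′ (v , 3F) K = class-step B-v′ 3F K (- A₀) (backward A₀ (+ 3))

  G-affine : Affine G
  G-affine = record { target = target′ ; slope = + 1 ; offset = offset′ ; law = law′ }
    where
    target′ : Class → Class
    target′ (s , 0F) = s , 3F
    target′ (s , 1F) = s , 2F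
    target′ (s , 2F) = s , 1F
    target′ (s , 3F) = s , 0F
    offset′ : Class → ℤ
    offset′ (u , 0F) = - + 1
    offset′ (u , 1F) = + 0
    offset′ (u , 2F) = + 0
    offset′ (u , 3F) = + 1
    offset′ (v , 0F) = M + A₀
    offset′ (v , 1F) = - (M + A₀) - + 1
    offset′ (v , 2F) = M + A₀ + + 1
    offset′ (v , 3F) = - (M + A₀)
    G-v′ : Alternates G v v (+ 4 * (M + A₀) + + 3)
    G-v′ = alternates-resp b≡4[M+A₀]+3 G-v
    v0 : ∀ y → + 1 * (+ 4 * y + + 3) ≡ + 4 * y + + 3 - + 0
    v0 = solve-∀
    v1 : ∀ y → - + 1 * (+ 4 * y + + 3) ≡ + 4 * (- y - + 1) + + 2 - + 1
    v1 = solve-∀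
    v2 : ∀ y → + 1 * (+ 4 * y + + 3) ≡ + 4 * (y + + 1) + + 1 - + 2
    v2 = solve-∀
    v3 : ∀ y → - + 1 * (+ 4 * y + + 3) ≡ + 4 * (- y) + + 0 - + 3
    v3 = solve-∀
    law′ : ∀ c K → G (at c K) ≡ at (target′ c) (K * + 1 + offset′ c)
    law′ (u , 0F) K = class-step G-u 0F K (- + 1) refl
    law′ (u , 1F) K = class-step G-u 1F K (+ 0) refl
    law′ (u , 2F) K = class-step G-u 2F K (+ 0) refl
    law′ (u , 3F) K = class-step G-u 3F K (+ 1) refl
    law′ (v , 0F) K = class-step G-v′ 0F K (M + A₀) (v0 (M + A₀))
    law′ (v , 1F) K = class-step G-v′ 1F K (- (M + A₀) - + 1) (v1 (M + A₀))
    law′ (v , 2F) K = class-step G-v′ 2F K (M + A₀ + + 1) (v2 (M + A₀))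
    law′ (v , 3F) K = class-step G-v′ 3F K (- (M + A₀)) (v3 (M + A₀))

  -- On v-vertices f is forced by f ∘ R = G ∘ f.
  f-target-u : Fin 4 → Class
  f-target-u 0F = u , 0F
  f-target-u 1F = u , 1F
  f-target-u 2F = v , 1F
  f-target-u 3F = v , 0F

  f-offset-u : Fin 4 → ℤ
  f-offset-u 3F = - A₀
  f-offset-u _  = + 0

  f : Vtx n → Vtx n
  f (u , k) = at (f-target-u (residue k)) (quotient k * - A₀ + f-offset-u (residue k))
  f (v , k) = G (f (u , k))

  f-u-law : ∀ r K → f (at (u , r) K) ≡ at (f-target-u r) (K * - A₀ + f-offset-u r)
  f-u-law r K = trans (cong (λ ρ → at (f-target-u ρ) (q * - A₀ + f-offset-u ρ)) ρ≡r)
                      (at-cong (f-target-u r) (q * - A₀ + f-offset-u r) (K * - A₀ + f-offset-u r)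
                               (∣m⇒∣m*n (- A₀) Q∣q-K ∣≡ regroup q K (- A₀) (f-offset-u r)))
    where
    k : Fin n
    k = proj₂ (at (u , r) K)
    q : ℤ
    q = quotient k
    ρ≡r×Q∣q-K : residue k ≡ r × + 2 * M ∣ q - K
    ρ≡r×Q∣q-K = at-injective {u} {residue k} {r} {q} {K} (at-residue u k)
    ρ≡r : residue k ≡ r
    ρ≡r = proj₁ ρ≡r×Q∣q-K
    Q∣q-K : + 2 * M ∣ q - K
    Q∣q-K = proj₂ ρ≡r×Q∣q-K
    regroup : ∀ q K s o → (q - K) * s ≡ (q * s + o) - (K * s + o)
    regroup = solve-∀

  f-affine : Affine f
  f-affine = record { target = target′ ; slope = - A₀ ; offset = offset′ ; law = law′ }
    where
    target′ : Class → Class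
    target′ (u , r) = f-target-u r
    target′ (v , r) = target G-affine (f-target-u r)
    offset′ : Class → ℤ
    offset′ (u , r) = f-offset-u r
    offset′ (v , r) = f-offset-u r * + 1 + offset G-affine (f-target-u r)
    law′ : ∀ c K → f (at c K) ≡ at (target′ c) (K * - A₀ + offset′ c)
    law′ (u , r) K = f-u-law r K
    law′ (v , r) K = begin
      G (f (at (u , r) K))                                          ≡⟨ cong G (f-u-law r K) ⟩
      G (at t (K * - A₀ + f-offset-u r))                            ≡⟨ law G-affine t (K * - A₀ + f-offset-u r) ⟩
      at (target G-affine t) ((K * - A₀ + f-offset-u r) * + 1 + offset G-affine t)
                                                                    ≡⟨ cong (at (target G-affine t)) (regroup K (- A₀) (f-offset-u r) (offset G-affine t)) ⟩
      at (target G-affine t) (K * - A₀ + (f-offset-u r * + 1 + offset G-affine t)) ∎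
      where
      open ≡-Reasoning
      t : Class
      t = f-target-u r
      regroup : ∀ K s o o′ → (K * s + o) * + 1 + o′ ≡ K * s + (o * + 1 + o′)
      regroup = solve-∀

  private
    Q∣[A₀-1]M : + 2 * M ∣ (A₀ - + 1) * M
    Q∣[A₀-1]M = divides C (trans (cong (λ x → (x - + 1) * M) A₀≡2C+1) (regroup C M))
      where
      regroup : ∀ C M → (+ 2 * C + + 1 - + 1) * M ≡ C * (+ 2 * M)
      regroup = solve-∀

    Q∣-combination : ∀ {x} α β γ → x ≡ α * (A₀ * A₀ - + 1) + β * ((A₀ - + 1) * M) + γ * (+ 2 * M) → + 2 * M ∣ x
    Q∣-combination α β γ x≡ = ∣m∣n⇒∣m+n (∣m∣n⇒∣m+n (∣n⇒∣m*n α 2M∣A₀²-1) (∣n⇒∣m*n β Q∣[A₀-1]M)) (∣n⇒∣m*n γ ∣-refl) ∣≡ sym x≡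

    Q∣x-x : ∀ x → + 2 * M ∣ x - x
    Q∣x-x x = divides (+ 0) (ℤ.+-inverseʳ x)

  f∘B≗B∘f : ∀ x → f (B x) ≡ B (f x)
  f∘B≗B∘f = affine-≗ (∘-affine B-affine f-affine) (∘-affine f-affine B-affine)
    (by-class refl refl refl refl refl refl refl refl)
    (Q∣-combination (+ 0) (+ 0) (+ 0) (slopes A₀ M))
    (by-class (Q∣x-x (+ 0)) (Q∣x-x (+ 0)) (Q∣x-x (+ 0 + - A₀)) (Q∣-combination (+ 0) (+ 0) (+ 0) (u3 A₀ M))
              (Q∣-combination (- + 1) (+ 0) (+ 0) (v0 A₀ M)) (Q∣-combination (+ 1) (+ 0) (+ 0) (v1 A₀ M))
              (Q∣-combination (- + 1) (+ 0) (+ 1) (v2 A₀ M)) (Q∣-combination (+ 1) (+ 0) (- + 1) (v3 A₀ M)))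
    where
    slopes : ∀ A M → + 1 * - A - - A * + 1 ≡ + 0 * (A * A - + 1) + + 0 * ((A - + 1) * M) + + 0 * (+ 2 * M)
    slopes = solve-∀
    u3 : ∀ A M → + 0 - (- A * + 1 + A) ≡ + 0 * (A * A - + 1) + + 0 * ((A - + 1) * M) + + 0 * (+ 2 * M)
    u3 = solve-∀
    v0 : ∀ A M → (A * - A + + 0) - - + 1 ≡ - + 1 * (A * A - + 1) + + 0 * ((A - + 1) * M) + + 0 * (+ 2 * M)
    v0 = solve-∀
    v1 : ∀ A M → (- A * - A + - + 1) - + 0 ≡ + 1 * (A * A - + 1) + + 0 * ((A - + 1) * M) + + 0 * (+ 2 * M)
    v1 = solve-∀
    v2 : ∀ A M → (A * - A + (- A * + 1 + (M + A))) - ((+ 0 + (- (M + A) - + 1)) * + 1 + A)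
                 ≡ - + 1 * (A * A - + 1) + + 0 * ((A - + 1) * M) + + 1 * (+ 2 * M)
    v2 = solve-∀
    v3 : ∀ A M → (- A * - A + (+ 0 + (- (M + A) - + 1))) - ((- A * + 1 + (M + A)) * + 1 + - A)
                 ≡ + 1 * (A * A - + 1) + + 0 * ((A - + 1) * M) + - + 1 * (+ 2 * M)
    v3 = solve-∀

  f-involutive : ∀ x → f (f x) ≡ x
  f-involutive = affine-≗ (∘-affine f-affine f-affine) id-affine
    (by-class refl refl refl refl refl refl refl refl)
    (Q∣-combination (+ 1) (+ 0) (+ 0) (slopes A₀ M))
    (by-class (Q∣x-x (+ 0)) (Q∣x-x (+ 0)) (Q∣x-x (+ 0)) (Q∣-combination (+ 1) (+ 0) (+ 0) (u3 A₀ M))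
              (Q∣-combination (+ 0) (+ 0) (+ 0) (v0 A₀ M)) (Q∣x-x (+ 0))
              (Q∣-combination (+ 1) (+ 1) (+ 0) (v2 A₀ M)) (Q∣-combination (+ 0) (- + 1) (+ 0) (v3 A₀ M)))
    where
    slopes : ∀ A M → - A * - A - + 1 ≡ + 1 * (A * A - + 1) + + 0 * ((A - + 1) * M) + + 0 * (+ 2 * M)
    slopes = solve-∀
    u3 : ∀ A M → (- A * - A + - + 1) - + 0 ≡ + 1 * (A * A - + 1) + + 0 * ((A - + 1) * M) + + 0 * (+ 2 * M)
    u3 = solve-∀
    v0 : ∀ A M → (- + 1 * - A + - A) - + 0 ≡ + 0 * (A * A - + 1) + + 0 * ((A - + 1) * M) + + 0 * (+ 2 * M)
    v0 = solve-∀
    v2 : ∀ A M → ((+ 0 + (- (M + A) - + 1)) * - A + (+ 0 + (- (M + A) - + 1))) - + 0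
                 ≡ + 1 * (A * A - + 1) + + 1 * ((A - + 1) * M) + + 0 * (+ 2 * M)
    v2 = solve-∀
    v3 : ∀ A M → ((- A * + 1 + (M + A)) * - A + (- A * + 1 + (M + A))) - + 0
                 ≡ + 0 * (A * A - + 1) + - + 1 * ((A - + 1) * M) + + 0 * (+ 2 * M)
    v3 = solve-∀

  f∘R≗G∘f : ∀ x → f (R x) ≡ G (f x)
  f∘R≗G∘f (u , k) = refl
  f∘R≗G∘f (v , k) = sym (G-involutive (f (u , k)))

  f∘G≗R∘f : ∀ x → f (G x) ≡ R (f x)
  f∘G≗R∘f x = begin
    f (G x)            ≡⟨ cong (λ y → f (G y)) (sym (f-involutive x)) ⟩
    f (G (f (f x)))    ≡⟨ cong f (sym (f∘R≗G∘f (f x))) ⟩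
    f (f (R (f x)))    ≡⟨ f-involutive (R (f x)) ⟩
    R (f x)            ∎
    where open ≡-Reasoning

  f-intertwines : Intertwining f
  f-intertwines = record { B-comm = f∘B≗B∘f ; G-to-R = f∘G≗R∘f ; R-to-G = f∘R≗G∘f }

  f-moves-v₀ : f (V v (+ 0)) ≢ V v (+ 0)
  f-moves-v₀ eq = u≢v (trans (sym (cong proj₁ (law f-affine (v , 0F) (+ 0)))) (cong proj₁ eq))
    where
    u≢v : u ≢ v
    u≢v ()

if-cases : ∀ {P A : Set} (D : Dec P) (x y : A) →
           ((if does D then x else y) ≡ x × (if does D then y else x) ≡ y × P) ⊎ (if does D then x else y) ≡ y
if-cases (yes p) x y = inj₁ (refl , refl , p)
if-cases (no _)  x y = inj₂ refl

xOf≡a⊎xOf≡b : ∀ n a b → (xOf n a b ≡ a × yOf n a b ≡ b × CongX n a b) ⊎ xOf n a b ≡ b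
xOf≡a⊎xOf≡b n a b = if-cases (n ℕ.∣? ∣ + a + + ((a ℕ.∸ 1) ℕ./ 2) * (+ a - + b) - + 1 ∣) a b

-- Otherwise v_a = v_b, but 0 < b - a < n.
v₀v_a∉Inner-b : ∀ {n a b} .{{_ : NonZero n}} → Even (+ n) → Odd (+ b) → a ℕ.< b → b ℕ.< n →
                ¬ Sym (Outer 0 ∪ Inner b) (vtx v 0) (vtx v a)
v₀v_a∉Inner-b {n} {a} {b} n-even b-odd a<b b<n edge =
  0<m<n⇒N∤m (ℕ.m<n⇒0<n∸m a<b) (ℕ.≤-<-trans (ℕ.m∸n≤m b a) b<n) (∣m⇒∣-m N∣ ∣≡ b-a)
  where
  open Matchings n n-even
  N∣ : N ∣ + a - (+ 0 + ε (+ 0) * + b)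
  N∣ = V-injective v (+ a) (+ 0 + ε (+ 0) * + b) (trans (mate-sound b-odd edge) (step (mate-v 0 b) (+ 0)))
  b-a : - (+ a - (+ 0 + + 1 * + b)) ≡ + (b ℕ.∸ a)
  b-a = trans (regroup (+ a) (+ b)) (trans (ℤ.m-n≡m⊖n b a) (ℤ.⊖-≥ (ℕ.<⇒≤ a<b)))
    where
    regroup : ∀ a b → - (a - (+ 0 + + 1 * b)) ≡ b - a
    regroup = solve-∀

module Proposition (n a b : ℕ) .{{_ : NonZero n}} (n-even : Even (+ n)) (a-odd : Odd (+ a)) (b-odd : Odd (+ b))
                   (2<n : 2 ℕ.< n) (a<b : a ℕ.< b) (b<n : b ℕ.< n) (y≡b : yOf n a b ≡ b) where

  open Colouring n a b n-even a-odd b-odd 2<n a<b b<n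

  Gc≡Gᶜ : Gc n a b ≡ Gᶜ
  Gc≡Gᶜ = cong (λ y → Sym (Outer 1 ∪ Inner y)) y≡b

  Swapping : Set
  Swapping = Σ (Vtx n → Vtx n) λ f → IsAutomorphism n a b f × HasOrder2 f × SwapsGR n a b f

  only-if : (a ℕ.+ 2 ℕ.< b) → (((b ℕ.∸ a) ℕ.* (b ℕ.∸ a) ℕ./ 2) ℕ.% n ≡ 2 ℕ.% n) → CongX n a b →
            (b ℕ.∸ 2 ℕ.< n ℕ.∸ a ℕ.∸ 2) → Swapping → Characterisation n a b
  only-if a+2<b square congX bound (f , (_ , preserves) , (f-involutive , _) , swaps) =
    Arithmetic.characterisation n a b b-odd a+2<b b<n square congX bound
      (Necessity.necessary n a b n-even a-odd b-odd 2<n a<b b<n f-involutive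
        (swapping⇒intertwining preserves (subst (λ G′ → SwapsWith G′ f) Gc≡Gᶜ swaps)))

  N≡8M : ∀ {m} → n ≡ m ℕ.* 8 → N ≡ + 8 * + m
  N≡8M {m} n≡m*8 = trans (cong +_ n≡m*8) (trans (ℤ.pos-* m 8) (ℤ.*-comm (+ m) (+ 8)))

  b≡4[M+A₀]+3 : ∀ {m a₀} → n ≡ m ℕ.* 8 → a ≡ 4 ℕ.* a₀ ℕ.+ 1 → b ≡ n ℕ./ 2 ℕ.+ a ℕ.+ 2 → + b ≡ + 4 * (+ m + + a₀) + + 3
  b≡4[M+A₀]+3 {m} {a₀} n≡m*8 a≡4a₀+1 b≡n/2+a+2 = begin
    + b                                  ≡⟨ cong +_ (trans b≡n/2+a+2 (cong (λ h → h ℕ.+ a ℕ.+ 2) n/2≡m*4)) ⟩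
    + (m ℕ.* 4 ℕ.+ a ℕ.+ 2)              ≡⟨ trans (ℤ.pos-+ (m ℕ.* 4 ℕ.+ a) 2) (cong (_+ + 2) (trans (ℤ.pos-+ (m ℕ.* 4) a)
                                                   (cong₂ _+_ (ℤ.pos-* m 4) (pos-4a₀+1 {a} {a₀} a≡4a₀+1)))) ⟩
    + m * + 4 + (+ 4 * + a₀ + + 1) + + 2  ≡⟨ regroup (+ m) (+ a₀) ⟩
    + 4 * (+ m + + a₀) + + 3              ∎
    where
    open ≡-Reasoning
    n/2≡m*4 : n ℕ./ 2 ≡ m ℕ.* 4
    n/2≡m*4 = trans (cong (ℕ._/ 2) (trans n≡m*8 (sym (ℕ.*-assoc m 4 2)))) (ℕ.m*n/n≡m (m ℕ.* 4) 2)
    regroup : ∀ M A → M * + 4 + (+ 4 * A + + 1) + + 2 ≡ + 4 * (M + A) + + 3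
    regroup = solve-∀

  2M∣A₀²-1 : ∀ {m a₀} → n ≡ m ℕ.* 8 → (4 ℕ.* a₀ ℕ.* a₀) ℕ.% n ≡ 4 ℕ.% n → + 2 * + m ∣ + a₀ * + a₀ - + 1
  2M∣A₀²-1 {m} {a₀} n≡m*8 4a₀²≡4 = *-cancelˡ-∣ (+ 4) (subst (_∣ + 4 * (+ a₀ * + a₀ - + 1)) N≡4[2M]
                                       (%ℕ≡⇒N∣ (+ (4 ℕ.* a₀ ℕ.* a₀)) (+ 4) 4a₀²≡4 ∣≡ factor))
    where
    regroup : ∀ M → + 8 * M ≡ + 4 * (+ 2 * M)
    regroup = solve-∀
    N≡4[2M] : N ≡ + 4 * (+ 2 * + m)
    N≡4[2M] = trans (N≡8M {m} n≡m*8) (regroup (+ m))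
    regroup′ : ∀ x → + 4 * x * x - + 4 ≡ + 4 * (x * x - + 1)
    regroup′ = solve-∀
    factor : + (4 ℕ.* a₀ ℕ.* a₀) - + 4 ≡ + 4 * (+ a₀ * + a₀ - + 1)
    factor = trans (cong (_- + 4) (trans (ℤ.pos-* (4 ℕ.* a₀) a₀) (cong (_* + a₀) (ℤ.pos-* 4 a₀)))) (regroup′ (+ a₀))

  A₀≡2C+1 : ∀ {a₀} (a₀-odd : ¬ 2 ℕ.∣ a₀) → + a₀ ≡ + 2 * _∣_.quotient (¬2∣⇒odd a₀-odd) + + 1
  A₀≡2C+1 {a₀} a₀-odd = trans (regroup (+ a₀)) (trans (cong (_+ + 1) (_∣_.equality (¬2∣⇒odd a₀-odd)))
                                                  (cong (_+ + 1) (ℤ.*-comm (_∣_.quotient (¬2∣⇒odd a₀-odd)) (+ 2))))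
    where
    regroup : ∀ x → x ≡ x - + 1 + + 1
    regroup = solve-∀

  if : Characterisation n a b → Swapping
  if (ℕ.divides m n≡m*8 , (a₀ , a≡4a₀+1 , _ , a₀-odd , 4a₀²≡4) , b≡n/2+a+2) =
    f , ((f , f-involutive , f-involutive) , proj₁ swapping) , (f-involutive , V v (+ 0) , f-moves-v₀)
      , subst (λ G′ → SwapsWith G′ f) (sym Gc≡Gᶜ) (proj₂ swapping)
    where
    open Sufficiency n a b n-even a-odd b-odd 2<n a<b b<n (+ m) (+ a₀) (_∣_.quotient (¬2∣⇒odd a₀-odd))
                     (N≡8M {m} n≡m*8) (A₀≡2C+1 {a₀} a₀-odd) (pos-4a₀+1 {a} {a₀} a≡4a₀+1)
                     (b≡4[M+A₀]+3 {m} {a₀} n≡m*8 a≡4a₀+1 b≡n/2+a+2) (2M∣A₀²-1 {m} {a₀} n≡m*8 4a₀²≡4)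
    swapping : PreservesEdges f × SwapsWith Gᶜ f
    swapping = intertwining⇒swapping f-involutive f-intertwines

proposition8p6 : ∀ n a b .{{_ : NonZero n}} → Feasible n a b → 1 < a
    → Bc n a b (vtx v 0) (vtx v a)
    → (Σ (Vtx n → Vtx n) λ f → IsAutomorphism n a b f × HasOrder2 f × SwapsGR n a b f)
      ⇔ Characterisation n a b
proposition8p6 n a b (2∣n , 4≤n , ¬2∣a , ¬2∣b , _ , a<b , b<n , _ , square , _ , _ , a+2<b , bound) _ v₀v_a∈B
  with xOf≡a⊎xOf≡b n a b
... | inj₁ (_ , y≡b , congX) = mk⇔ (only-if a+2<b square congX bound) if
  where
  open Proposition n a b (∣ᵤ⇒∣ 2∣n) (¬2∣⇒odd ¬2∣a) (¬2∣⇒odd ¬2∣b) (ℕ.<-≤-trans (ℕ.s≤s (ℕ.s≤s (ℕ.s≤s ℕ.z≤n))) 4≤n) a<b b<n y≡b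
... | inj₂ x≡b = ⊥-elim (v₀v_a∉Inner-b (∣ᵤ⇒∣ 2∣n) (¬2∣⇒odd ¬2∣b) a<b b<n
                          (subst (λ x → Sym (Outer 0 ∪ Inner x) (vtx v 0) (vtx v a)) x≡b v₀v_a∈B))
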